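{- Let $r \geq 5$ be an integer and let $H$ be the graph defined below. Then $H$ has order $3r+1$, the vertices $u$ and $v$ have degree $r-1$, the other $3r-1$ vertices have degree $r$, and the edge $z_1z_2$ is contained in precisely $(2r-8)\,((r-4)!)^2\,((r-1)!)$ hamiltonian $uv$-paths of $H$.
   Context: For an integer $r \geq 5$, $H$ is the simple graph with vertex set $\{u, v, z_1, z_2, z_3, z_4, u', z_1'\} \cup \{x_1, \ldots, x_{r-2}\} \cup \{y_1, \ldots, y_{r-4}\} \cup \{t_1, \ldots, t_{r-1}\}$ (all distinct) and the following edges: $uu'$ and $ux_i$ for $1 \leq i \leq r-2$; $vz_3$, $vz_4$ and $vx_i$ for $2 \leq i \leq r-2$; $z_1z_1'$, $z_1z_2$ and $z_1x_i$ for $1 \leq i \leq r-2$; $z_2z_3$, $z_2z_4$ and $z_2x_i$ for $1 \leq i \leq r-3$; $z_3z_4$, $z_3x_1$, $z_4x_{r-2}$; $z_3y_j$ and $z_4y_j$ for $1 \leq j \leq r-4$; $x_iy_j$ for all $1 \leq i \leq r-2$, $1 \leq j \leq r-4$; and all edges among $\{u', z_1', t_1, \ldots, t_{r-1}\}$ except $u'z_1'$ (i.e. these $r+1$ vertices induce $K_{r+1}$ minus the edge $u'z_1'$). A hamiltonian $uv$-path is a path from $u$ to $v$ visiting every vertex exactly once. -}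

module Defs where

open import Data.Nat using (ℕ; _+_; _*_; _∸_; _<_; _^_)
open import Data.Fin using (Fin; toℕ)
open import Data.List using (List; []; _∷_; _++_; head; last)
open import Data.List.Relation.Unary.Linked using (Linked)
open import Data.List.Relation.Unary.Unique.Propositional using (Unique)
open import Data.List.Membership.Propositional using (_∈_)
open import Data.Maybe using (just)
open import Data.Product using (Σ; ∃; _×_)
open import Data.Sum using (_⊎_)
open import Relation.Binary.PropositionalEquality using (_≡_; _≢_)

-- Vertices of H (indices are 0-based: x i stands for x_{i+1}, etc.)
data Vtx (r : ℕ) : Set where
  u v z₁ z₂ z₃ z₄ u' z₁' : Vtx r
  x : Fin (r ∸ 2) → Vtx r
  y : Fin (r ∸ 4) → Vtx r
  t : Fin (r ∸ 1) → Vtx r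

-- The edges of H, each listed once (in one orientation).
data E (r : ℕ) : Vtx r → Vtx r → Set where
  e-uu'   : E r u u'
  e-ux    : ∀ i → E r u (x i)
  e-vz₃   : E r v z₃
  e-vz₄   : E r v z₄
  e-vx    : ∀ i → 1 Data.Nat.≤ toℕ i → E r v (x i)          -- 2 ≤ i ≤ r-2
  e-z₁z₁' : E r z₁ z₁'
  e-z₁z₂  : E r z₁ z₂
  e-z₁x   : ∀ i → E r z₁ (x i)
  e-z₂z₃  : E r z₂ z₃
  e-z₂z₄  : E r z₂ z₄
  e-z₂x   : ∀ i → toℕ i < r ∸ 3 → E r z₂ (x i)             -- 1 ≤ i ≤ r-3
  e-z₃z₄  : E r z₃ z₄
  e-z₃x₁  : ∀ i → toℕ i ≡ 0 → E r z₃ (x i)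
  e-z₄x   : ∀ i → toℕ i ≡ r ∸ 3 → E r z₄ (x i)             -- x_{r-2}
  e-z₃y   : ∀ j → E r z₃ (y j)
  e-z₄y   : ∀ j → E r z₄ (y j)
  e-xy    : ∀ i j → E r (x i) (y j)
  -- K_{r+1} on {u', z₁', t_1..t_{r-1}} minus the edge u'z₁'
  e-u't   : ∀ k → E r u' (t k)
  e-z₁'t  : ∀ k → E r z₁' (t k)
  e-tt    : ∀ k l → toℕ k < toℕ l → E r (t k) (t l)

Adj : (r : ℕ) → Vtx r → Vtx r → Set
Adj r a b = E r a b ⊎ E r b a

HasCard : (A : Set) → (A → Set) → ℕ → Set
HasCard A P n =
  Σ (Fin n → A) λ f →
    (∀ i → P (f i)) ×
    (∀ i j → f i ≡ f j → i ≡ j) ×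
    (∀ a → P a → ∃ λ i → f i ≡ a)

HasDegree : (r : ℕ) → Vtx r → ℕ → Set
HasDegree r a d = HasCard (Vtx r) (Adj r a) d

HamUVPath : (r : ℕ) → List (Vtx r) → Set
HamUVPath r p =
  head p ≡ just u ×
  last p ≡ just v ×
  Linked (Adj r) p ×
  Unique p ×
  (∀ w → w ∈ p)

UsesEdge : {r : ℕ} → Vtx r → Vtx r → List (Vtx r) → Set
UsesEdge a b p =
  ∃ λ pre → ∃ λ post → (p ≡ pre ++ a ∷ b ∷ post) ⊎ (p ≡ pre ++ b ∷ a ∷ post)

{-# OPTIONS --safe #-}

-- The clique K = {u', z₁', t₁, …, t_{r−1}} is joined to the rest of H only by the edges uu' and z₁z₁'.
-- A hamiltonian uv-path using z₁z₂ therefore starts u u', traverses K ending in z₁' and continues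
-- z₁ z₂; the order of the t's gives the factor (r−1)!. From z₂ to v it visits the independent sets
-- X = {x_i} and Y = {y_j}, where |X| = |Y| + 2, together with z₃ and z₄, each of which has a single
-- neighbour in X. On an X/Y-alternating segment the X's outnumber the Y's by at most one, and by one
-- only if the segment begins and ends in X; comparing counts on the three segments cut out by z₃ and
-- z₄ shows that z₃z₄ is an edge of the path, flanked by two such segments. So the path is determined
-- by the order of the t's, the orders of the r−4 inner x's and of the r−4 y's, the orientation of
-- x₁z₃z₄x_{r−2} and the point where it is inserted, and the theorem follows from this bijection.

module Submission where

open import Defs
open import Data.Nat using (ℕ; zero; suc; _+_; _*_; _∸_; _^_; _!; _⊓_; _≤_; _<_; z≤n; s≤s)
import Data.Nat.Properties as ℕ
open import Data.Nat.Tactic.RingSolver using (solve-∀)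
open import Data.Fin as Fin
  using (Fin; zero; suc; toℕ; fromℕ; fromℕ<; inject₁; lower₁; punchIn; punchOut; splitAt; _↑ˡ_; _↑ʳ_; combine; remQuot)
import Data.Fin.Properties as Fin
open import Data.Fin.Patterns using (0F; 1F; 2F; 3F; 4F; 5F; 6F; 7F)
open import Data.List using (List; []; _∷_; _++_; length; map; allFin; tabulate; lookup; take; drop; filter; last)
import Data.List.Properties as List
open import Data.List.Relation.Unary.All as All using (All; []; _∷_)
open import Data.List.Relation.Unary.All.Properties using (¬Any⇒All¬; All¬⇒¬Any) renaming (++⁺ to All-++⁺)
open import Data.List.Relation.Unary.Any as Any using (Any; here; there; index)
open import Data.List.Relation.Unary.Any.Properties using (lookup-index)
open import Data.List.Relation.Unary.Linked as Linked using (Linked; []; [-]; _∷_)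
open import Data.List.Relation.Unary.Unique.Propositional using (Unique; []; _∷_)
import Data.List.Relation.Unary.Unique.Propositional.Properties as Unique
open import Data.List.Relation.Unary.Unique.Propositional.Properties using (Unique[x∷xs]⇒x∉xs)
open import Data.List.Membership.Propositional using (_∈_; _∉_)
import Data.List.Membership.Propositional.Properties as ∈
open import Data.List.Membership.Propositional.Properties
  using (∈-++⁺ˡ; ∈-++⁺ʳ; ∈-++⁻; ∈-∃++; ∈-filter⁺; ∈-filter⁻)
open import Data.List.Relation.Binary.Subset.Propositional using (_⊆_)
open import Data.Maybe using (just)
open import Data.Bool using (if_then_else_)
open import Data.Product using (∃; _×_; _,_; proj₁; proj₂; uncurry)
open import Data.Sum as Sum using (_⊎_; inj₁; inj₂)
import Data.Sum.Properties as Sum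
open import Data.Unit using (⊤; tt)
open import Data.Empty using (⊥; ⊥-elim)
open import Function using (_∘_; _∘′_)
open import Relation.Nullary using (¬_; ¬?; yes; no; does)
open import Relation.Nullary.Decidable using (decidable-stable)
open import Relation.Unary using (U; Decidable; _⟨⊎⟩_; _⟨×⟩_)
open import Relation.Binary using (tri<; tri≈; tri>)
open import Relation.Binary.PropositionalEquality

module _ {A : Set} where

  Unique-++⁻ˡ : ∀ xs {ys : List A} → Unique (xs ++ ys) → Unique xs
  Unique-++⁻ˡ [] _ = []
  Unique-++⁻ˡ (_ ∷ xs) (a∉ ∷ xs!) = All.tabulate (All.lookup a∉ ∘ ∈-++⁺ˡ) ∷ Unique-++⁻ˡ xs xs!

  Unique-++⁻ʳ : ∀ xs {ys : List A} → Unique (xs ++ ys) → Unique ys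
  Unique-++⁻ʳ [] ys! = ys!
  Unique-++⁻ʳ (_ ∷ xs) (_ ∷ xs!) = Unique-++⁻ʳ xs xs!

  Unique-++-disjoint : ∀ xs {ys : List A} {w} → Unique (xs ++ ys) → w ∈ xs → w ∉ ys
  Unique-++-disjoint (_ ∷ xs) (a∉ ∷ _) (here refl) w∈ys = All.lookup a∉ (∈-++⁺ʳ xs w∈ys) refl
  Unique-++-disjoint (_ ∷ xs) (_ ∷ xs!) (there w∈xs) = Unique-++-disjoint xs xs! w∈xs

  Unique-∷⁻ : ∀ {a : A} {xs} → Unique (a ∷ xs) → Unique xs
  Unique-∷⁻ (_ ∷ xs!) = xs!

  Unique-mid∉ : ∀ xs {b : A} {ys} → Unique (xs ++ b ∷ ys) → b ∉ xs ++ ys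
  Unique-mid∉ [] (b∉ ∷ _) b∈ = All.lookup b∉ b∈ refl
  Unique-mid∉ (_ ∷ xs) (a∉ ∷ _) (here refl) = All.lookup a∉ (∈-++⁺ʳ xs (here refl)) refl
  Unique-mid∉ (_ ∷ xs) (_ ∷ xs!) (there b∈) = Unique-mid∉ xs xs! b∈

  Unique-removeMid : ∀ xs {b : A} {ys} → Unique (xs ++ b ∷ ys) → Unique (xs ++ ys)
  Unique-removeMid [] (_ ∷ ys!) = ys!
  Unique-removeMid (_ ∷ xs) (a∉ ∷ xs!) = skip xs a∉ ∷ Unique-removeMid xs xs!
    where
    skip : ∀ {P : A → Set} {b ys} xs → All P (xs ++ b ∷ ys) → All P (xs ++ ys)
    skip [] (_ ∷ ps) = ps
    skip (_ ∷ xs) (p ∷ ps) = p ∷ skip xs ps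

  ++-∷-injective-first : ∀ {Q : A → Set} xs {a b ys xs' ys'} →
    All (¬_ ∘ Q) xs → All (¬_ ∘ Q) xs' → Q a → Q b →
    xs ++ a ∷ ys ≡ xs' ++ b ∷ ys' → xs ≡ xs' × a ≡ b × ys ≡ ys'
  ++-∷-injective-first [] {xs' = []} _ _ _ _ refl = refl , refl , refl
  ++-∷-injective-first [] {xs' = _ ∷ _} _ (¬qa ∷ _) qa _ refl = ⊥-elim (¬qa qa)
  ++-∷-injective-first (_ ∷ _) {xs' = []} (¬qb ∷ _) _ _ qb refl = ⊥-elim (¬qb qb)
  ++-∷-injective-first (_ ∷ xs) {xs' = _ ∷ _} (_ ∷ ¬Q) (_ ∷ ¬Q') qa qb e
    with refl , e' ← List.∷-injective e
    with refl , refl , refl ← ++-∷-injective-first xs ¬Q ¬Q' qa qb e' = refl , refl , refl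

  ++-∷-injective : ∀ xs {a : A} {ys xs' ys'} → a ∉ xs → a ∉ xs' →
    xs ++ a ∷ ys ≡ xs' ++ a ∷ ys' → xs ≡ xs' × ys ≡ ys'
  ++-∷-injective xs a∉xs a∉xs' e
    with eq , _ , eq' ← ++-∷-injective-first xs (¬Any⇒All¬ _ a∉xs) (¬Any⇒All¬ _ a∉xs') refl refl e
    = eq , eq'

  ++-injective-length : ∀ (xs : List A) {ys xs' ys'} → length xs ≡ length xs' →
    xs ++ ys ≡ xs' ++ ys' → xs ≡ xs' × ys ≡ ys'
  ++-injective-length [] {xs' = []} _ e = refl , e
  ++-injective-length (_ ∷ xs) {xs' = _ ∷ xs'} len e
    with refl , e' ← List.∷-injective e
    with refl , refl ← ++-injective-length xs {xs' = xs'} (ℕ.suc-injective len) e' = refl , refl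

  last-++-∷ : ∀ xs {a : A} ys → last (xs ++ a ∷ ys) ≡ last (a ∷ ys)
  last-++-∷ [] _ = refl
  last-++-∷ (_ ∷ []) _ = refl
  last-++-∷ (_ ∷ b ∷ xs) ys = last-++-∷ (b ∷ xs) ys

  last-∈ : ∀ (xs : List A) {w} → last xs ≡ just w → w ∈ xs
  last-∈ (_ ∷ []) refl = here refl
  last-∈ (_ ∷ b ∷ xs) e = there (last-∈ (b ∷ xs) e)

  last⇒∷ʳ : ∀ (xs : List A) {w} → last xs ≡ just w → ∃ λ ys → xs ≡ ys ++ w ∷ []
  last⇒∷ʳ (_ ∷ []) refl = [] , refl
  last⇒∷ʳ (a ∷ b ∷ xs) e with ys , eq ← last⇒∷ʳ (b ∷ xs) e = a ∷ ys , cong (a ∷_) eq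

  ∈-++-∷⁻ : ∀ {w a} xs {ys : List A} → w ∈ xs ++ a ∷ ys → w ≡ a ⊎ w ∈ xs ++ ys
  ∈-++-∷⁻ xs w∈ with ∈-++⁻ xs w∈
  ... | inj₁ w∈xs = inj₂ (∈-++⁺ˡ w∈xs)
  ... | inj₂ (here e) = inj₁ e
  ... | inj₂ (there w∈ys) = inj₂ (∈-++⁺ʳ xs w∈ys)

  ∈-++-∷⁺ : ∀ {w a} xs {ys : List A} → w ∈ xs ++ ys → w ∈ xs ++ a ∷ ys
  ∈-++-∷⁺ xs w∈ with ∈-++⁻ xs w∈
  ... | inj₁ w∈xs = ∈-++⁺ˡ w∈xs
  ... | inj₂ w∈ys = ∈-++⁺ʳ xs (there w∈ys)

  ∈-split : ∀ {w} ys {xs zs : List A} → xs ≡ ys ++ w ∷ zs → w ∈ xs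
  ∈-split ys eq = subst (_ ∈_) (sym eq) (∈-++⁺ʳ ys (here refl))

  ∈-split-next : ∀ {a w} ys {xs zs : List A} → xs ≡ ys ++ a ∷ w ∷ zs → w ∈ xs
  ∈-split-next ys eq = subst (_ ∈_) (sym eq) (∈-++⁺ʳ ys (there (here refl)))

  first-exit : ∀ {P : A → Set} → Decidable P → ∀ {a l} → P a → Any (¬_ ∘ P) l →
    ∃ λ L → ∃ λ b → ∃ λ c → ∃ λ M → a ∷ l ≡ L ++ b ∷ c ∷ M × All P L × P b × ¬ P c
  first-exit P? {a} {c ∷ l} pa (here ¬pc) = [] , a , c , l , refl , [] , pa , ¬pc
  first-exit P? {a} {c ∷ l} pa (there any) with P? c
  ... | no ¬pc = [] , a , c , l , refl , [] , pa , ¬pc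
  ... | yes pc with L , b , c' , M , eq , all , pb , ¬pc' ← first-exit P? pc any =
    a ∷ L , b , c' , M , cong (a ∷_) eq , pa ∷ all , pb , ¬pc'

  length-filter-++-∷ : ∀ {P : A → Set} (P? : Decidable P) xs {a ys} → ¬ P a →
    length (filter P? (xs ++ a ∷ ys)) ≡ length (filter P? xs) + length (filter P? ys)
  length-filter-++-∷ P? xs {a} {ys} ¬pa = begin
    length (filter P? (xs ++ a ∷ ys))              ≡⟨ cong length (List.filter-++ P? xs (a ∷ ys)) ⟩
    length (filter P? xs ++ filter P? (a ∷ ys))    ≡⟨ List.length-++ (filter P? xs) ⟩
    length (filter P? xs) + length (filter P? (a ∷ ys))
                                                   ≡⟨ cong (λ l → length (filter P? xs) + length l) (List.filter-reject P? ¬pa) ⟩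
    length (filter P? xs) + length (filter P? ys)  ∎
    where open ≡-Reasoning

module _ {A : Set} {n} (f : Fin n → A) where

  length-tabulate : length (map f (allFin n)) ≡ n
  length-tabulate = trans (List.length-map f (allFin n)) (List.length-tabulate (λ i → i))

  ∈-tabulate⁺ : ∀ i → f i ∈ map f (allFin n)
  ∈-tabulate⁺ i = ∈.∈-map⁺ f (∈.∈-allFin i)

  ∈-tabulate⁻ : ∀ {w} → w ∈ map f (allFin n) → ∃ λ i → w ≡ f i
  ∈-tabulate⁻ w∈ with i , _ , e ← ∈.∈-map⁻ f w∈ = i , e

module _ {A : Set} {R : A → A → Set} where

  Linked-++⁻ˡ : ∀ xs {ys} → Linked R (xs ++ ys) → Linked R xs
  Linked-++⁻ˡ [] _ = []
  Linked-++⁻ˡ (_ ∷ []) _ = [-]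
  Linked-++⁻ˡ (_ ∷ b ∷ xs) (r ∷ rs) = r ∷ Linked-++⁻ˡ (b ∷ xs) rs

  Linked-++⁻ʳ : ∀ xs {ys} → Linked R (xs ++ ys) → Linked R ys
  Linked-++⁻ʳ [] rs = rs
  Linked-++⁻ʳ (_ ∷ xs) rs = Linked-++⁻ʳ xs (Linked.tail rs)

  Linked-++-∷⁻ : ∀ xs {a b ys} → Linked R (xs ++ a ∷ b ∷ ys) → R a b
  Linked-++-∷⁻ xs rs = Linked.head (Linked-++⁻ʳ xs rs)

module _ {A : Set} where

  interleave : List A → List A → List A
  interleave (a ∷ as) (b ∷ bs) = a ∷ b ∷ interleave as bs
  interleave _ _ = []

  length-interleave : ∀ as bs → length as ≡ length bs →
    length (interleave as bs) ≡ length as + length bs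
  length-interleave [] [] _ = refl
  length-interleave (_ ∷ as) (_ ∷ bs) e =
    cong suc (trans (cong suc (length-interleave as bs (ℕ.suc-injective e)))
                    (sym (ℕ.+-suc (length as) (length bs))))

  ∈-interleave⁺ˡ : ∀ {w} as bs → length as ≡ length bs → w ∈ as → w ∈ interleave as bs
  ∈-interleave⁺ˡ (_ ∷ _) (_ ∷ _) _ (here e) = here e
  ∈-interleave⁺ˡ (_ ∷ as) (_ ∷ bs) e (there w∈) =
    there (there (∈-interleave⁺ˡ as bs (ℕ.suc-injective e) w∈))

  ∈-interleave⁺ʳ : ∀ {w} as bs → length as ≡ length bs → w ∈ bs → w ∈ interleave as bs
  ∈-interleave⁺ʳ (_ ∷ _) (_ ∷ _) _ (here e) = there (here e)
  ∈-interleave⁺ʳ (_ ∷ as) (_ ∷ bs) e (there w∈) =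
    there (there (∈-interleave⁺ʳ as bs (ℕ.suc-injective e) w∈))

  interleave-injective : ∀ as bs as' bs' → length as ≡ length bs → length as' ≡ length bs' →
    interleave as bs ≡ interleave as' bs' → as ≡ as' × bs ≡ bs'
  interleave-injective [] [] [] [] _ _ _ = refl , refl
  interleave-injective (_ ∷ as) (_ ∷ bs) (_ ∷ as') (_ ∷ bs') e e' q
    with refl , q' ← List.∷-injective q
    with refl , q'' ← List.∷-injective q'
    with refl , refl ← interleave-injective as bs as' bs' (ℕ.suc-injective e) (ℕ.suc-injective e') q''
    = refl , refl
  interleave-injective [] [] (_ ∷ _) (_ ∷ _) _ _ ()
  interleave-injective (_ ∷ _) (_ ∷ _) [] [] _ _ ()

  All-interleave : ∀ {P : A → Set} {as bs} → All P as → All P bs → All P (interleave as bs)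
  All-interleave (pa ∷ pas) (pb ∷ pbs) = pa ∷ pb ∷ All-interleave pas pbs
  All-interleave [] _ = []
  All-interleave (_ ∷ _) [] = []

  interleave-∷ʳ : ∀ as bs {e : A} → length as ≡ length bs →
    ∃ λ a → ∃ λ as' → a ∷ as' ≡ as ++ e ∷ [] × length bs ≡ length as' ×
      interleave as bs ++ e ∷ [] ≡ a ∷ interleave bs as'
  interleave-∷ʳ [] [] _ = _ , [] , refl , refl , refl
  interleave-∷ʳ (a ∷ as) (b ∷ bs) e
    with a' , as' , eq , len , eq' ← interleave-∷ʳ as bs (ℕ.suc-injective e) =
    a , a' ∷ as' , cong (a ∷_) eq , cong suc len , cong (λ l → a ∷ b ∷ l) eq'

  module _ {P : A → Set} (P? : Decidable P) where

    filter-interleave-accept : ∀ {as bs} → All P as → All (¬_ ∘ P) bs → length as ≡ length bs →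
      filter P? (interleave as bs) ≡ as
    filter-interleave-accept [] [] _ = refl
    filter-interleave-accept {a ∷ as} {b ∷ bs} (pa ∷ pas) (¬pb ∷ ¬pbs) e = begin
      filter P? (a ∷ b ∷ interleave as bs) ≡⟨ List.filter-accept P? pa ⟩
      a ∷ filter P? (b ∷ interleave as bs) ≡⟨ cong (a ∷_) (List.filter-reject P? ¬pb) ⟩
      a ∷ filter P? (interleave as bs)     ≡⟨ cong (a ∷_) (filter-interleave-accept pas ¬pbs (ℕ.suc-injective e)) ⟩
      a ∷ as                               ∎
      where open ≡-Reasoning

    filter-interleave-reject : ∀ {as bs} → All (¬_ ∘ P) as → All P bs → length as ≡ length bs →
      filter P? (interleave as bs) ≡ bs
    filter-interleave-reject [] [] _ = refl
    filter-interleave-reject {a ∷ as} {b ∷ bs} (¬pa ∷ ¬pas) (pb ∷ pbs) e = begin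
      filter P? (a ∷ b ∷ interleave as bs) ≡⟨ List.filter-reject P? ¬pa ⟩
      filter P? (b ∷ interleave as bs)     ≡⟨ List.filter-accept P? pb ⟩
      b ∷ filter P? (interleave as bs)     ≡⟨ cong (b ∷_) (filter-interleave-reject ¬pas pbs (ℕ.suc-injective e)) ⟩
      b ∷ bs                               ∎
      where open ≡-Reasoning

module Alternating {A : Set} {R : A → A → Set} {P Q : A → Set}
  (PQ : ∀ {a b} → P a → Q b → R a b) (QP : ∀ {a b} → Q a → P b → R a b) where

  Linked-interleave : ∀ {s as bs h rest} → length as ≡ length bs → All P as → All Q bs →
    (∀ {a} → P a → R s a) → R s h → (∀ {b} → Q b → R b h) → Linked R (h ∷ rest) →
    Linked R (s ∷ interleave as bs ++ h ∷ rest)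
  Linked-interleave {as = []} {[]} _ _ _ _ sh _ rs = sh ∷ rs
  Linked-interleave {as = _ ∷ _} {_ ∷ _} e (pa ∷ pas) (qb ∷ qbs) sP _ Qh rs =
    sP pa ∷ PQ pa qb ∷ Linked-interleave (ℕ.suc-injective e) pas qbs (QP qb) (Qh qb) Qh rs

  Linked-interleave⁺ : ∀ {s as bs h rest} → 0 < length as → length as ≡ length bs →
    All P as → All Q bs → (∀ {a} → P a → R s a) → (∀ {b} → Q b → R b h) → Linked R (h ∷ rest) →
    Linked R (s ∷ interleave as bs ++ h ∷ rest)
  Linked-interleave⁺ {as = _ ∷ _} {_ ∷ _} _ e (pa ∷ pas) (qb ∷ qbs) sP Qh rs =
    sP pa ∷ PQ pa qb ∷ Linked-interleave (ℕ.suc-injective e) pas qbs (QP qb) (Qh qb) Qh rs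

module _ {A : Set} where

  take-length-++ : ∀ (xs : List A) {ys} → take (length xs) (xs ++ ys) ≡ xs
  take-length-++ [] = refl
  take-length-++ (a ∷ xs) = cong (a ∷_) (take-length-++ xs)

  drop-length-++ : ∀ (xs : List A) {ys} → drop (length xs) (xs ++ ys) ≡ ys
  drop-length-++ [] = refl
  drop-length-++ (_ ∷ xs) = drop-length-++ xs

  ∈-take⁻ : ∀ {w} n (xs : List A) → w ∈ take n xs → w ∈ xs
  ∈-take⁻ n xs w∈ = subst (_ ∈_) (List.take++drop≡id n xs) (∈-++⁺ˡ w∈)

  ∈-drop⁻ : ∀ {w} n (xs : List A) → w ∈ drop n xs → w ∈ xs
  ∈-drop⁻ n xs w∈ = subst (_ ∈_) (List.take++drop≡id n xs) (∈-++⁺ʳ (take n xs) w∈)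

  ∈-take-drop⁻ : ∀ {w} n (xs : List A) → w ∈ xs → w ∈ take n xs ⊎ w ∈ drop n xs
  ∈-take-drop⁻ n xs w∈ = ∈-++⁻ (take n xs) (subst (_ ∈_) (sym (List.take++drop≡id n xs)) w∈)

  All-take : ∀ {P : A → Set} {xs} n → All P xs → All P (take n xs)
  All-take {xs = xs} n all = All.tabulate (All.lookup all ∘ ∈-take⁻ n xs)

  All-drop : ∀ {P : A → Set} {xs} n → All P xs → All P (drop n xs)
  All-drop {xs = xs} n all = All.tabulate (All.lookup all ∘ ∈-drop⁻ n xs)

  length-take-≤ : ∀ n (xs : List A) → n ≤ length xs → length (take n xs) ≡ n
  length-take-≤ n xs n≤ = trans (List.length-take n xs) (ℕ.m≤n⇒m⊓n≡m n≤)

  weave : ℕ → List A → List A → List A → List A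
  weave n α β m = interleave (take n α) (take n β) ++ m ++ interleave (drop n β) (drop n α)

  module _ {α β : List A} (α≡β : length α ≡ length β) (n : ℕ) where

    length-take≡ : length (take n α) ≡ length (take n β)
    length-take≡ = trans (List.length-take n α) (trans (cong (n ⊓_) α≡β) (sym (List.length-take n β)))

    length-drop≡ : length (drop n β) ≡ length (drop n α)
    length-drop≡ = trans (List.length-drop n β) (trans (cong (_∸ n) (sym α≡β)) (sym (List.length-drop n α)))

    private
      in-front : ∀ {m} → interleave (take n α) (take n β) ⊆ weave n α β m
      in-front = ∈-++⁺ˡ
      in-back : ∀ {m} → interleave (drop n β) (drop n α) ⊆ weave n α β m
      in-back {m} = ∈-++⁺ʳ (interleave (take n α) (take n β)) ∘ ∈-++⁺ʳ m

    ⊆-weave : ∀ {m} → α ++ β ++ m ⊆ weave n α β m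
    ⊆-weave {m} w∈ with ∈-++⁻ α w∈
    ... | inj₁ w∈α with ∈-take-drop⁻ n α w∈α
    ...   | inj₁ w∈take = in-front (∈-interleave⁺ˡ (take n α) (take n β) length-take≡ w∈take)
    ...   | inj₂ w∈drop = in-back (∈-interleave⁺ʳ (drop n β) (drop n α) length-drop≡ w∈drop)
    ⊆-weave {m} w∈ | inj₂ w∈β++m with ∈-++⁻ β w∈β++m
    ... | inj₂ w∈m = ∈-++⁺ʳ (interleave (take n α) (take n β)) (∈-++⁺ˡ w∈m)
    ... | inj₁ w∈β with ∈-take-drop⁻ n β w∈β
    ...   | inj₁ w∈take = in-front (∈-interleave⁺ʳ (take n α) (take n β) length-take≡ w∈take)
    ...   | inj₂ w∈drop = in-back (∈-interleave⁺ˡ (drop n β) (drop n α) length-drop≡ w∈drop)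

    length-weave : ∀ m → length (weave n α β m) ≡ length α + length α + length m
    length-weave m = begin
      length (interleave (take n α) (take n β) ++ m ++ interleave (drop n β) (drop n α))
        ≡⟨ List.length-++ (interleave (take n α) (take n β)) ⟩
      length (interleave (take n α) (take n β)) + length (m ++ interleave (drop n β) (drop n α))
        ≡⟨ cong₂ _+_ (length-interleave (take n α) (take n β) length-take≡) (List.length-++ m) ⟩
      (length (take n α) + length (take n β)) + (length m + length (interleave (drop n β) (drop n α)))
        ≡⟨ cong (λ l → (length (take n α) + length (take n β)) + (length m + l))
                (length-interleave (drop n β) (drop n α) length-drop≡) ⟩
      (a + b) + (length m + (c + d))
        ≡⟨ cong₂ (λ b c → (a + b) + (length m + (c + d))) (sym length-take≡) length-drop≡ ⟩
      (a + a) + (length m + (d + d))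
        ≡⟨ rearrange a d (length m) ⟩
      (a + d) + (a + d) + length m
        ≡⟨ cong (λ l → l + l + length m) (trans (sym (List.length-++ (take n α))) (cong length (List.take++drop≡id n α))) ⟩
      length α + length α + length m
        ∎
      where
      open ≡-Reasoning
      a = length (take n α)
      b = length (take n β)
      c = length (drop n β)
      d = length (drop n α)
      rearrange : ∀ a d m → (a + a) + (m + (d + d)) ≡ (a + d) + (a + d) + m
      rearrange = solve-∀

  weave-length-++ : ∀ as {bs as' bs' : List A} m → length as ≡ length bs →
    weave (length as) (as ++ as') (bs ++ bs') m ≡ interleave as bs ++ m ++ interleave bs' as'
  weave-length-++ as {bs} {as'} {bs'} m as≡bs
    rewrite take-length-++ as {as'} | drop-length-++ as {as'} | as≡bs
          | take-length-++ bs {bs'} | drop-length-++ bs {bs'} = refl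

  weave-injective : ∀ {Q : A → Set} n n' {α β α' β' a a' m m'} →
    length α ≡ length β → length α' ≡ length β' → n ≤ length α → n' ≤ length α' →
    All (¬_ ∘ Q) α → All (¬_ ∘ Q) β → All (¬_ ∘ Q) α' → All (¬_ ∘ Q) β' →
    Q a → Q a' → length m ≡ length m' →
    weave n α β (a ∷ m) ≡ weave n' α' β' (a' ∷ m') →
    n ≡ n' × α ≡ α' × β ≡ β' × a ≡ a' × m ≡ m'
  weave-injective {Q} n n' {α} {β} {α'} {β'} {m = m} {m'}
    α≡β α'≡β' n≤ n'≤ ¬Qα ¬Qβ ¬Qα' ¬Qβ' qa qa' m≡m' e
    with heads , refl , tails ← ++-∷-injective-first (interleave (take n α) (take n β))
                                 (All-interleave (All-take n ¬Qα) (All-take n ¬Qβ))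
                                 (All-interleave (All-take n' ¬Qα') (All-take n' ¬Qβ')) qa qa' e
    with takeα , takeβ ← interleave-injective _ _ _ _ (length-take≡ α≡β n) (length-take≡ α'≡β' n') heads
    with refl , rests ← ++-injective-length m {xs' = m'} m≡m' tails
    with dropβ , dropα ← interleave-injective _ _ _ _ (length-drop≡ α≡β n) (length-drop≡ α'≡β' n') rests
    with refl ← trans (sym (length-take-≤ n α n≤)) (trans (cong length takeα) (length-take-≤ n' α' n'≤))
    = refl , glue α α' takeα dropα , glue β β' takeβ dropβ , refl , refl
    where
    glue : ∀ xs xs' → take n xs ≡ take n xs' → drop n xs ≡ drop n xs' → xs ≡ xs'
    glue xs xs' e₁ e₂ = trans (sym (List.take++drop≡id n xs))
                          (trans (cong₂ _++_ e₁ e₂) (List.take++drop≡id n xs'))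

module _ {A B : Set} {P : A → Set} {Q : B → Set} where

  HasCard-bijection : ∀ {n} (g : A → B) →
    (∀ {a} → P a → Q (g a)) →
    (∀ {a a'} → P a → P a' → g a ≡ g a' → a ≡ a') →
    (∀ {b} → Q b → ∃ λ a → P a × g a ≡ b) →
    HasCard A P n → HasCard B Q n
  HasCard-bijection g pres inj surj (f , Pf , f-inj , f-surj) =
    g ∘ f , pres ∘ Pf , (λ i j e → f-inj i j (inj (Pf i) (Pf j) e)) , enum
    where
    enum : ∀ b → Q b → ∃ λ i → g (f i) ≡ b
    enum b qb with surj qb
    ... | a , pa , refl with f-surj a pa
    ...   | i , refl = i , refl

  HasCard-⊎ : ∀ {n m} → HasCard A P n → HasCard B Q m → HasCard (A ⊎ B) (P ⟨⊎⟩ Q) (n + m)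
  HasCard-⊎ {n} {m} (f , Pf , f-inj , f-surj) (g , Qg , g-inj , g-surj) =
    h ∘ splitAt n , pres , inj , surj
    where
    h : Fin n ⊎ Fin m → A ⊎ B
    h (inj₁ i) = inj₁ (f i)
    h (inj₂ j) = inj₂ (g j)
    pres : ∀ i → (P ⟨⊎⟩ Q) (h (splitAt n i))
    pres i with splitAt n i
    ... | inj₁ i' = Pf i'
    ... | inj₂ j' = Qg j'
    h-inj : ∀ s s' → h s ≡ h s' → s ≡ s'
    h-inj (inj₁ i) (inj₁ i') e = cong inj₁ (f-inj i i' (Sum.inj₁-injective e))
    h-inj (inj₂ j) (inj₂ j') e = cong inj₂ (g-inj j j' (Sum.inj₂-injective e))
    inj : ∀ i j → h (splitAt n i) ≡ h (splitAt n j) → i ≡ j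
    inj i j e = begin
      i                          ≡⟨ Fin.join-splitAt n m i ⟨
      Fin.join n m (splitAt n i) ≡⟨ cong (Fin.join n m) (h-inj _ _ e) ⟩
      Fin.join n m (splitAt n j) ≡⟨ Fin.join-splitAt n m j ⟩
      j                          ∎
      where open ≡-Reasoning
    surj : ∀ s → (P ⟨⊎⟩ Q) s → ∃ λ i → h (splitAt n i) ≡ s
    surj (inj₁ a) pa with f-surj a pa
    ... | i , refl = i ↑ˡ m , cong h (Fin.splitAt-↑ˡ n i m)
    surj (inj₂ b) qb with g-surj b qb
    ... | j , refl = n ↑ʳ j , cong h (Fin.splitAt-↑ʳ n m j)

  HasCard-× : ∀ {n m} → HasCard A P n → HasCard B Q m → HasCard (A × B) (P ⟨×⟩ Q) (n * m)
  HasCard-× {n} {m} (f , Pf , f-inj , f-surj) (g , Qg , g-inj , g-surj) =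
    h ∘ remQuot m , (λ i → Pf _ , Qg _) , inj , surj
    where
    h : Fin n × Fin m → A × B
    h (i , j) = f i , g j
    inj : ∀ i j → h (remQuot m i) ≡ h (remQuot m j) → i ≡ j
    inj i j e = begin
      i                                 ≡⟨ Fin.combine-remQuot {n} m i ⟨
      uncurry combine (remQuot {n} m i) ≡⟨ cong (uncurry combine) remQuot-eq ⟩
      uncurry combine (remQuot {n} m j) ≡⟨ Fin.combine-remQuot {n} m j ⟩
      j                                 ∎
      where
      open ≡-Reasoning
      remQuot-eq : remQuot {n} m i ≡ remQuot m j
      remQuot-eq = cong₂ _,_ (f-inj _ _ (cong proj₁ e)) (g-inj _ _ (cong proj₂ e))
    surj : ∀ ab → (P ⟨×⟩ Q) ab → ∃ λ i → h (remQuot m i) ≡ ab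
    surj (a , b) (pa , qb) with f-surj a pa | g-surj b qb
    ... | i , refl | j , refl = combine i j , cong h (Fin.remQuot-combine i j)

HasCard-Fin : ∀ n → HasCard (Fin n) (λ _ → ⊤) n
HasCard-Fin n = (λ i → i) , (λ _ → tt) , (λ _ _ e → e) , λ i _ → i , refl

module _ {A : Set} where

  lookup-injective : ∀ {L : List A} → Unique L → ∀ i j → lookup L i ≡ lookup L j → i ≡ j
  lookup-injective {_ ∷ L} _ zero zero _ = refl
  lookup-injective {_ ∷ L} (a∉ ∷ _) zero (suc j) e = ⊥-elim (All.lookup a∉ (∈.∈-lookup j) e)
  lookup-injective {_ ∷ L} (a∉ ∷ _) (suc i) zero e = ⊥-elim (All.lookup a∉ (∈.∈-lookup i) (sym e))
  lookup-injective {_ ∷ L} (_ ∷ L!) (suc i) (suc j) e = cong suc (lookup-injective L! i j e)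

  HasCard-fromList : ∀ {P : A → Set} (L : List A) → Unique L →
    (∀ {a} → P a → a ∈ L) → (∀ {a} → a ∈ L → P a) → HasCard A P (length L)
  HasCard-fromList L L! complete sound =
    lookup L , sound ∘ ∈.∈-lookup , lookup-injective L! ,
    λ a pa → index (complete pa) , sym (lookup-index (complete pa))

module _ {A : Set} where

  Arrangement : List A → List A → Set
  Arrangement base l = Unique l × l ⊆ base × base ⊆ l

  insertAt : ℕ → A → List A → List A
  insertAt zero b l = b ∷ l
  insertAt (suc n) b [] = b ∷ []
  insertAt (suc n) b (c ∷ l) = c ∷ insertAt n b l

  ∈-insertAt⁻ : ∀ n {b w} l → w ∈ insertAt n b l → w ≡ b ⊎ w ∈ l
  ∈-insertAt⁻ zero _ (here e) = inj₁ e
  ∈-insertAt⁻ zero _ (there w∈) = inj₂ w∈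
  ∈-insertAt⁻ (suc n) [] (here e) = inj₁ e
  ∈-insertAt⁻ (suc n) (_ ∷ _) (here e) = inj₂ (here e)
  ∈-insertAt⁻ (suc n) (_ ∷ l) (there w∈) = Sum.map₂ there (∈-insertAt⁻ n l w∈)

  ∈-insertAt-here : ∀ n {b} l → b ∈ insertAt n b l
  ∈-insertAt-here zero _ = here refl
  ∈-insertAt-here (suc n) [] = here refl
  ∈-insertAt-here (suc n) (_ ∷ l) = there (∈-insertAt-here n l)

  ∈-insertAt⁺ : ∀ n {b} l → l ⊆ insertAt n b l
  ∈-insertAt⁺ zero _ w∈ = there w∈
  ∈-insertAt⁺ (suc n) (_ ∷ _) (here e) = here e
  ∈-insertAt⁺ (suc n) (_ ∷ l) (there w∈) = there (∈-insertAt⁺ n l w∈)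

  insertAt-unique : ∀ n {b} l → b ∉ l → Unique l → Unique (insertAt n b l)
  insertAt-unique zero l b∉ l! = All.tabulate (λ { w∈ refl → b∉ w∈ }) ∷ l!
  insertAt-unique (suc n) [] _ _ = [] ∷ []
  insertAt-unique (suc n) {b} (c ∷ l) b∉ (c∉ ∷ l!) =
    All.tabulate (c≢ ∘ ∈-insertAt⁻ n l) ∷ insertAt-unique n l (b∉ ∘ there) l!
    where
    c≢ : ∀ {w} → w ≡ b ⊎ w ∈ l → c ≢ w
    c≢ (inj₁ refl) refl = b∉ (here refl)
    c≢ (inj₂ w∈) refl = All.lookup c∉ w∈ refl

  insertAt-injective : ∀ n n' {b} l l' → n ≤ length l → n' ≤ length l' → b ∉ l → b ∉ l' →
    insertAt n b l ≡ insertAt n' b l' → n ≡ n' × l ≡ l'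
  insertAt-injective zero zero _ _ _ _ _ _ refl = refl , refl
  insertAt-injective zero (suc _) _ (_ ∷ _) _ _ _ b∉l' refl = ⊥-elim (b∉l' (here refl))
  insertAt-injective (suc _) zero (_ ∷ _) _ _ _ b∉l _ refl = ⊥-elim (b∉l (here refl))
  insertAt-injective (suc n) (suc n') (_ ∷ l) (_ ∷ l') (s≤s n≤) (s≤s n'≤) b∉l b∉l' e
    with refl , e' ← List.∷-injective e
    with refl , refl ← insertAt-injective n n' l l' n≤ n'≤ (b∉l ∘ there) (b∉l' ∘ there) e'
    = refl , refl

  insertAt-length : ∀ xs {b ys} → insertAt (length xs) b (xs ++ ys) ≡ xs ++ b ∷ ys
  insertAt-length [] = refl
  insertAt-length (c ∷ xs) = cong (c ∷_) (insertAt-length xs)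

  private
    length-++-∷ : ∀ xs {b : A} {ys} → length (xs ++ b ∷ ys) ≡ suc (length (xs ++ ys))
    length-++-∷ [] = refl
    length-++-∷ (_ ∷ xs) = cong suc (length-++-∷ xs)

    ⊆-removeMid : ∀ {b : A} {bs} xs {ys} → b ∉ bs → b ∷ bs ⊆ xs ++ b ∷ ys → bs ⊆ xs ++ ys
    ⊆-removeMid xs b∉ ⊆xs w∈ with ∈-++⁻ xs (⊆xs (there w∈))
    ... | inj₁ w∈xs = ∈-++⁺ˡ w∈xs
    ... | inj₂ (here refl) = ⊥-elim (b∉ w∈)
    ... | inj₂ (there w∈ys) = ∈-++⁺ʳ xs w∈ys

  length-≤-⊆ : ∀ base {l} → Unique base → base ⊆ l → length base ≤ length l
  length-≤-⊆ [] _ _ = z≤n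
  length-≤-⊆ (b ∷ bs) {l} (b∉ ∷ bs!) ⊆l with xs , ys , refl ← ∈-∃++ {xs = l} (⊆l (here refl)) =
    subst (suc (length bs) ≤_) (sym (length-++-∷ xs {b} {ys}))
      (s≤s (length-≤-⊆ bs bs! (⊆-removeMid xs (All¬⇒¬Any b∉) ⊆l)))

  Unique-⊆-length : ∀ base {l} → Unique base → base ⊆ l → length l ≤ length base → Unique l
  Unique-⊆-length [] {[]} _ _ _ = []
  Unique-⊆-length (b ∷ bs) {l} (b∉ ∷ bs!) ⊆l len with xs , ys , refl ← ∈-∃++ {xs = l} (⊆l (here refl)) =
    subst Unique (insertAt-length xs) (insertAt-unique (length xs) (xs ++ ys) b∉xs++ys xs++ys!)
    where
    bs⊆ = ⊆-removeMid xs (All¬⇒¬Any b∉) ⊆l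
    len' : length (xs ++ ys) ≤ length bs
    len' = ℕ.≤-pred (subst (_≤ suc (length bs)) (length-++-∷ xs {b} {ys}) len)
    xs++ys! = Unique-⊆-length bs bs! bs⊆ len'
    b∉xs++ys : b ∉ xs ++ ys
    b∉xs++ys b∈ = ℕ.<-irrefl refl (ℕ.≤-trans (length-≤-⊆ (b ∷ bs) (b∉ ∷ bs!) b∷bs⊆) len')
      where
      b∷bs⊆ : b ∷ bs ⊆ xs ++ ys
      b∷bs⊆ (here refl) = b∈
      b∷bs⊆ (there w∈) = bs⊆ w∈

  Arrangement-length : ∀ {base l : List A} → Unique base → Arrangement base l → length l ≡ length base
  Arrangement-length base! (l! , l⊆ , ⊆l) =
    ℕ.≤-antisym (length-≤-⊆ _ l! l⊆) (length-≤-⊆ _ base! ⊆l)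

  Arrangement-removeMid : ∀ {b : A} {bs} xs {ys} → Unique (b ∷ bs) →
    Arrangement (b ∷ bs) (xs ++ b ∷ ys) → Arrangement bs (xs ++ ys)
  Arrangement-removeMid {b} xs {ys} (b∉ ∷ _) (l! , l⊆ , ⊆l) =
    Unique-removeMid xs l! , ⊆bs , ⊆-removeMid xs (All¬⇒¬Any b∉) ⊆l
    where
    ⊆bs : xs ++ ys ⊆ _
    ⊆bs w∈ with l⊆ (∈-++-∷⁺ xs w∈)
    ... | here refl = ⊥-elim (Unique-mid∉ xs l! w∈)
    ... | there w∈bs = w∈bs

  Arrangement-insertAt : ∀ n {b : A} {bs l} → b ∉ bs → Arrangement bs l → Arrangement (b ∷ bs) (insertAt n b l)
  Arrangement-insertAt n {b} {bs} {l} b∉bs (l! , l⊆ , ⊆l) = insertAt-unique n l (b∉bs ∘ l⊆) l! , ⊆b∷bs , b∷bs⊆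
    where
    ⊆b∷bs : insertAt n b l ⊆ b ∷ bs
    ⊆b∷bs w∈ with ∈-insertAt⁻ n l w∈
    ... | inj₁ refl = here refl
    ... | inj₂ w∈l = there (l⊆ w∈l)
    b∷bs⊆ : b ∷ bs ⊆ insertAt n b l
    b∷bs⊆ (here refl) = ∈-insertAt-here n l
    b∷bs⊆ (there w∈) = ∈-insertAt⁺ n l (⊆l w∈)

  HasCard-Arrangement : ∀ base → Unique base → HasCard (List A) (Arrangement base) (length base !)
  HasCard-Arrangement [] _ =
    (λ _ → []) , (λ _ → [] , (λ ()) , λ ()) , (λ { zero zero _ → refl }) , surj
    where
    surj : ∀ l → Arrangement [] l → ∃ λ i → [] ≡ l
    surj [] _ = zero , refl
    surj (_ ∷ _) (_ , l⊆ , _) with () ← l⊆ (here refl)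
  HasCard-Arrangement (b ∷ bs) b∷bs!@(b∉ ∷ bs!) =
    HasCard-bijection insert pres inj surj (HasCard-× (HasCard-Fin (suc (length bs))) (HasCard-Arrangement bs bs!))
    where
    insert : Fin (suc (length bs)) × List A → List A
    insert (i , l) = insertAt (toℕ i) b l
    b∉bs : b ∉ bs
    b∉bs = All¬⇒¬Any b∉
    toℕ≤ : ∀ (i : Fin (suc (length bs))) {l} → Arrangement bs l → toℕ i ≤ length l
    toℕ≤ i arr = subst (toℕ i ≤_) (sym (Arrangement-length bs! arr)) (ℕ.≤-pred (Fin.toℕ<n i))
    pres : ∀ {il} → ((λ _ → ⊤) ⟨×⟩ Arrangement bs) il → Arrangement (b ∷ bs) (insert il)
    pres {i , _} (_ , arr) = Arrangement-insertAt (toℕ i) b∉bs arr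
    inj : ∀ {il il'} → ((λ _ → ⊤) ⟨×⟩ Arrangement bs) il → ((λ _ → ⊤) ⟨×⟩ Arrangement bs) il' →
      insert il ≡ insert il' → il ≡ il'
    inj {i , l} {i' , l'} (_ , arr) (_ , arr') e
      with i≡ , refl ← insertAt-injective (toℕ i) (toℕ i') l l' (toℕ≤ i arr) (toℕ≤ i' arr')
                          (b∉bs ∘ proj₁ (proj₂ arr)) (b∉bs ∘ proj₁ (proj₂ arr')) e
      = cong (_, l) (Fin.toℕ-injective i≡)
    surj : ∀ {l} → Arrangement (b ∷ bs) l → ∃ λ il → ((λ _ → ⊤) ⟨×⟩ Arrangement bs) il × insert il ≡ l
    surj arr@(_ , _ , ⊆l) with xs , ys , refl ← ∈-∃++ (⊆l (here refl)) =
      (fromℕ< xs< , xs ++ ys) , (tt , arr') ,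
      trans (cong (λ n → insertAt n b (xs ++ ys)) (Fin.toℕ-fromℕ< xs<)) (insertAt-length xs)
      where
      arr' = Arrangement-removeMid xs b∷bs! arr
      xs< : length xs < suc (length bs)
      xs< = s≤s (subst (length xs ≤_) (Arrangement-length bs! arr') (List.length-++-≤ˡ xs))

module _ {A : Set} {n} {f : Fin n → A} {l : List A} where

  Arrangement-tabulate-length : Unique (map f (allFin n)) → Arrangement (map f (allFin n)) l → length l ≡ n
  Arrangement-tabulate-length f! arr = trans (Arrangement-length f! arr) (length-tabulate f)

  Arrangement-tabulate-All : ∀ {P : A → Set} → (∀ i → P (f i)) → Arrangement (map f (allFin n)) l → All P l
  Arrangement-tabulate-All {P} Pf (_ , l⊆ , _) =
    All.tabulate λ w∈ → let i , e = ∈-tabulate⁻ f (l⊆ w∈) in subst P (sym e) (Pf i)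

module Graph (k : ℕ) where

  r : ℕ
  r = 5 + k

  V : Set
  V = Vtx r

  _~_ : V → V → Set
  _~_ = Adj r

  x₁ xᵣ₋₂ : V
  x₁ = x zero
  xᵣ₋₂ = x (fromℕ (2 + k))

  inner : Fin (1 + k) → V
  inner j = x (suc (inject₁ j))

  data XView : Fin (3 + k) → Set where
    is-first : XView zero
    is-last  : XView (fromℕ (2 + k))
    is-inner : ∀ j → XView (suc (inject₁ j))

  x-view : ∀ i → XView i
  x-view zero = is-first
  x-view (suc i) with toℕ i ℕ.≟ suc k
  ... | yes e = subst (XView ∘′ suc) (sym (Fin.toℕ-injective (trans e (sym (Fin.toℕ-fromℕ (suc k)))))) is-last
  ... | no ne = subst (XView ∘′ suc) (Fin.inject₁-lower₁ i (ne ∘′ sym)) (is-inner (lower₁ i (ne ∘′ sym)))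

  ts inners ys : List V
  ts = map t (allFin (4 + k))
  inners = map inner (allFin (1 + k))
  ys = map y (allFin (1 + k))

  IsX IsY IsT IsInner : V → Set
  IsX w = ∃ λ i → w ≡ x i
  IsY w = ∃ λ j → w ≡ y j
  IsT w = ∃ λ l → w ≡ t l
  IsInner w = ∃ λ j → w ≡ inner j

  data InClique : V → Set where
    u'∈K  : InClique u'
    z₁'∈K : InClique z₁'
    t∈K   : ∀ l → InClique (t l)

  IsX? : Decidable IsX
  IsX? u = no λ ()
  IsX? v = no λ ()
  IsX? z₁ = no λ ()
  IsX? z₂ = no λ ()
  IsX? z₃ = no λ ()
  IsX? z₄ = no λ ()
  IsX? u' = no λ ()
  IsX? z₁' = no λ ()
  IsX? (x i) = yes (i , refl)
  IsX? (y _) = no λ ()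
  IsX? (t _) = no λ ()

  IsY? : Decidable IsY
  IsY? u = no λ ()
  IsY? v = no λ ()
  IsY? z₁ = no λ ()
  IsY? z₂ = no λ ()
  IsY? z₃ = no λ ()
  IsY? z₄ = no λ ()
  IsY? u' = no λ ()
  IsY? z₁' = no λ ()
  IsY? (x _) = no λ ()
  IsY? (y j) = yes (j , refl)
  IsY? (t _) = no λ ()

  InClique? : Decidable InClique
  InClique? u = no λ ()
  InClique? v = no λ ()
  InClique? z₁ = no λ ()
  InClique? z₂ = no λ ()
  InClique? z₃ = no λ ()
  InClique? z₄ = no λ ()
  InClique? u' = yes u'∈K
  InClique? z₁' = yes z₁'∈K
  InClique? (x _) = no λ ()
  InClique? (y _) = no λ ()
  InClique? (t l) = yes (t∈K l)

  x-injective : ∀ {i j} → x {r} i ≡ x j → i ≡ j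
  x-injective refl = refl

  y-injective : ∀ {i j} → y {r} i ≡ y j → i ≡ j
  y-injective refl = refl

  t-injective : ∀ {i j} → t {r} i ≡ t j → i ≡ j
  t-injective refl = refl

  inner-injective : ∀ {j j'} → inner j ≡ inner j' → j ≡ j'
  inner-injective e = Fin.inject₁-injective (Fin.suc-injective (x-injective e))

  inner≢x₁ : ∀ j → inner j ≢ x₁
  inner≢x₁ j ()

  inner≢xᵣ₋₂ : ∀ j → inner j ≢ xᵣ₋₂
  inner≢xᵣ₋₂ j e = Fin.toℕ-inject₁-≢ j
    (trans (sym (Fin.toℕ-fromℕ (suc k))) (cong toℕ (sym (Fin.suc-injective (x-injective e)))))

  Unique-ts : Unique ts
  Unique-ts = Unique.map⁺ t-injective (Unique.allFin⁺ _)

  Unique-inners : Unique inners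
  Unique-inners = Unique.map⁺ inner-injective (Unique.allFin⁺ _)

  Unique-ys : Unique ys
  Unique-ys = Unique.map⁺ y-injective (Unique.allFin⁺ _)

  Unique-xs : Unique (map (x {r}) (allFin (3 + k)))
  Unique-xs = Unique.map⁺ x-injective (Unique.allFin⁺ _)

  ~-sym : ∀ {a b} → a ~ b → b ~ a
  ~-sym (inj₁ e) = inj₂ e
  ~-sym (inj₂ e) = inj₁ e

  t~t : ∀ l l' → l ≢ l' → t l ~ t l'
  t~t l l' l≢l' with ℕ.<-cmp (toℕ l) (toℕ l')
  ... | tri< lt _ _ = inj₁ (e-tt l l' lt)
  ... | tri≈ _ eq _ = ⊥-elim (l≢l' (Fin.toℕ-injective eq))
  ... | tri> _ _ gt = inj₂ (e-tt l' l gt)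

  x~y : ∀ {a b} → IsX a → IsY b → a ~ b
  x~y (i , refl) (j , refl) = inj₁ (e-xy i j)

  y~x : ∀ {a b} → IsY a → IsX b → a ~ b
  y~x pa pb = ~-sym (x~y pb pa)

  inner⇒IsX : ∀ {w} → IsInner w → IsX w
  inner⇒IsX (j , refl) = _ , refl

  z₂~inner : ∀ {w} → IsInner w → z₂ ~ w
  z₂~inner (j , refl) = inj₁ (e-z₂x _ (subst (_< 2 + k) (sym toℕ-suc-inject₁) (s≤s (Fin.toℕ<n j))))
    where
    toℕ-suc-inject₁ : toℕ {3 + k} (suc (inject₁ j)) ≡ suc (toℕ j)
    toℕ-suc-inject₁ = cong suc (Fin.toℕ-inject₁ j)

  inner~v : ∀ {w} → IsInner w → w ~ v
  inner~v (j , refl) = inj₂ (e-vx _ (s≤s z≤n))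

  xᵣ₋₂~v : xᵣ₋₂ ~ v
  xᵣ₋₂~v = inj₂ (e-vx _ (s≤s z≤n))

  z₄~xᵣ₋₂ : z₄ ~ xᵣ₋₂
  z₄~xᵣ₋₂ = inj₁ (e-z₄x _ (Fin.toℕ-fromℕ (2 + k)))

  z₃~x₁ : z₃ ~ x₁
  z₃~x₁ = inj₁ (e-z₃x₁ zero refl)

  z₂~x₁ : z₂ ~ x₁
  z₂~x₁ = inj₁ (e-z₂x zero (s≤s z≤n))

  ¬x~x : ∀ {a b} → IsX a → IsX b → ¬ a ~ b
  ¬x~x (_ , refl) (_ , refl) (inj₁ ())
  ¬x~x (_ , refl) (_ , refl) (inj₂ ())

  ¬y~y : ∀ {a b} → IsY a → IsY b → ¬ a ~ b
  ¬y~y (_ , refl) (_ , refl) (inj₁ ())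
  ¬y~y (_ , refl) (_ , refl) (inj₂ ())

  ¬z₂~xᵣ₋₂ : ¬ z₂ ~ xᵣ₋₂
  ¬z₂~xᵣ₋₂ (inj₁ (e-z₂x _ lt)) = ℕ.<-irrefl (Fin.toℕ-fromℕ (2 + k)) lt

  ¬x₁~v : ¬ x₁ ~ v
  ¬x₁~v (inj₂ (e-vx _ ()))

  z₃-x-neighbour : ∀ {w} → z₃ ~ w → IsX w → w ≡ x₁
  z₃-x-neighbour (inj₁ (e-z₃x₁ i e)) _ = cong x (Fin.toℕ-injective e)
  z₃-x-neighbour (inj₂ ()) (_ , refl)

  z₄-x-neighbour : ∀ {w} → z₄ ~ w → IsX w → w ≡ xᵣ₋₂
  z₄-x-neighbour (inj₁ (e-z₄x i e)) _ = cong x (Fin.toℕ-injective (trans e (sym (Fin.toℕ-fromℕ (2 + k)))))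
  z₄-x-neighbour (inj₂ ()) (_ , refl)

  clique-boundary : ∀ {a c} → a ~ c → ¬ InClique a → InClique c →
    (a ≡ u × c ≡ u') ⊎ (a ≡ z₁ × c ≡ z₁')
  clique-boundary (inj₁ e-uu') _ _ = inj₁ (refl , refl)
  clique-boundary (inj₁ e-z₁z₁') _ _ = inj₂ (refl , refl)
  clique-boundary (inj₁ (e-u't _)) ¬ca _ = ⊥-elim (¬ca u'∈K)
  clique-boundary (inj₁ (e-z₁'t _)) ¬ca _ = ⊥-elim (¬ca z₁'∈K)
  clique-boundary (inj₁ (e-tt l _ _)) ¬ca _ = ⊥-elim (¬ca (t∈K l))
  clique-boundary (inj₂ (e-u't l)) ¬ca _ = ⊥-elim (¬ca (t∈K l))
  clique-boundary (inj₂ (e-z₁'t l)) ¬ca _ = ⊥-elim (¬ca (t∈K l))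
  clique-boundary (inj₂ (e-tt _ l _)) ¬ca _ = ⊥-elim (¬ca (t∈K l))

module OrderAndDegrees (k : ℕ) where
  open Graph k

  Code : Set
  Code = Fin 8 ⊎ Fin (3 + k) ⊎ Fin (1 + k) ⊎ Fin (4 + k)

  encode : V → Code
  encode u = inj₁ 0F
  encode v = inj₁ 1F
  encode z₁ = inj₁ 2F
  encode z₂ = inj₁ 3F
  encode z₃ = inj₁ 4F
  encode z₄ = inj₁ 5F
  encode u' = inj₁ 6F
  encode z₁' = inj₁ 7F
  encode (x i) = inj₂ (inj₁ i)
  encode (y j) = inj₂ (inj₂ (inj₁ j))
  encode (t l) = inj₂ (inj₂ (inj₂ l))

  decode : Code → V
  decode (inj₁ 0F) = u
  decode (inj₁ 1F) = v
  decode (inj₁ 2F) = z₁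
  decode (inj₁ 3F) = z₂
  decode (inj₁ 4F) = z₃
  decode (inj₁ 5F) = z₄
  decode (inj₁ 6F) = u'
  decode (inj₁ 7F) = z₁'
  decode (inj₂ (inj₁ i)) = x i
  decode (inj₂ (inj₂ (inj₁ j))) = y j
  decode (inj₂ (inj₂ (inj₂ l))) = t l

  decode-encode : ∀ w → decode (encode w) ≡ w
  decode-encode u = refl
  decode-encode v = refl
  decode-encode z₁ = refl
  decode-encode z₂ = refl
  decode-encode z₃ = refl
  decode-encode z₄ = refl
  decode-encode u' = refl
  decode-encode z₁' = refl
  decode-encode (x i) = refl
  decode-encode (y j) = refl
  decode-encode (t l) = refl

  encode-decode : ∀ c → encode (decode c) ≡ c
  encode-decode (inj₁ 0F) = refl
  encode-decode (inj₁ 1F) = refl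
  encode-decode (inj₁ 2F) = refl
  encode-decode (inj₁ 3F) = refl
  encode-decode (inj₁ 4F) = refl
  encode-decode (inj₁ 5F) = refl
  encode-decode (inj₁ 6F) = refl
  encode-decode (inj₁ 7F) = refl
  encode-decode (inj₂ (inj₁ i)) = refl
  encode-decode (inj₂ (inj₂ (inj₁ j))) = refl
  encode-decode (inj₂ (inj₂ (inj₂ l))) = refl

  AnyCode : Code → Set
  AnyCode = (λ _ → ⊤) ⟨⊎⟩ (λ _ → ⊤) ⟨⊎⟩ (λ _ → ⊤) ⟨⊎⟩ (λ _ → ⊤)

  anyCode : ∀ c → AnyCode c
  anyCode (inj₁ _) = tt
  anyCode (inj₂ (inj₁ _)) = tt
  anyCode (inj₂ (inj₂ (inj₁ _))) = tt
  anyCode (inj₂ (inj₂ (inj₂ _))) = tt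

  order : HasCard V (λ _ → ⊤) (3 * r + 1)
  order = subst (HasCard V (λ _ → ⊤)) (size k) (HasCard-bijection decode (λ _ → tt)
    (λ {c} {c'} _ _ e → trans (sym (encode-decode c)) (trans (cong encode e) (encode-decode c')))
    (λ {w} _ → encode w , anyCode (encode w) , decode-encode w)
    (HasCard-⊎ (HasCard-Fin 8) (HasCard-⊎ (HasCard-Fin (3 + k)) (HasCard-⊎ (HasCard-Fin (1 + k)) (HasCard-Fin (4 + k))))))
    where
    size : ∀ n → 8 + (3 + n + (1 + n + (4 + n))) ≡ 3 * (5 + n) + 1
    size = solve-∀

  vertices : List V
  vertices = tabulate (proj₁ order)

  Unique-vertices : Unique vertices
  Unique-vertices = Unique.tabulate⁺ {f = proj₁ order} (proj₁ (proj₂ (proj₂ order)) _ _)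

  length-vertices : length vertices ≡ 3 * r + 1
  length-vertices = List.length-tabulate (proj₁ order)

  module _ (bs : List V) {n} (f : Fin n → V) where

    ∈-neighbours : ∀ i → f i ∈ bs ++ map f (allFin n)
    ∈-neighbours i = ∈.∈-++⁺ʳ bs (∈-tabulate⁺ f i)

    HasDegree-fromList : ∀ {a} → Unique bs → (∀ i → All (_≢ f i) bs) → (∀ {i j} → f i ≡ f j → i ≡ j) →
      (∀ {b} → a ~ b → b ∈ bs ++ map f (allFin n)) → (∀ {b} → b ∈ bs ++ map f (allFin n) → a ~ b) →
      HasDegree r a (length bs + n)
    HasDegree-fromList {a} bs! bs≢f f-injective complete sound =
      subst (HasDegree r a) (trans (List.length-++ bs) (cong (length bs +_) (length-tabulate f)))
        (HasCard-fromList (bs ++ map f (allFin n)) (Unique.++⁺ bs! (Unique.map⁺ f-injective (Unique.allFin⁺ n)) disjoint)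
          complete sound)
      where
      disjoint : ∀ {w} → w ∈ bs × w ∈ map f (allFin n) → ⊥
      disjoint (w∈bs , w∈f) with i , refl ← ∈-tabulate⁻ f w∈f = All.lookup (bs≢f i) w∈bs refl

  degree-u : HasDegree r u (r ∸ 1)
  degree-u = HasDegree-fromList (u' ∷ []) x ([] ∷ []) (λ _ → (λ ()) ∷ []) x-injective complete sound
    where
    complete : ∀ {b} → u ~ b → b ∈ (u' ∷ []) ++ map x (allFin (3 + k))
    complete (inj₁ e-uu') = here refl
    complete (inj₁ (e-ux i)) = ∈-neighbours (u' ∷ []) x i
    sound : ∀ {b} → b ∈ (u' ∷ []) ++ map x (allFin (3 + k)) → u ~ b
    sound (here refl) = inj₁ e-uu'
    sound (there b∈) with i , refl ← ∈-tabulate⁻ x b∈ = inj₁ (e-ux i)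

  degree-v : HasDegree r v (r ∸ 1)
  degree-v = HasDegree-fromList (z₃ ∷ z₄ ∷ []) (x ∘ suc) (((λ ()) ∷ []) ∷ [] ∷ []) (λ _ → (λ ()) ∷ (λ ()) ∷ [])
    (Fin.suc-injective ∘ x-injective) complete sound
    where
    complete : ∀ {b} → v ~ b → b ∈ (z₃ ∷ z₄ ∷ []) ++ map (x ∘ suc) (allFin (2 + k))
    complete (inj₁ e-vz₃) = here refl
    complete (inj₁ e-vz₄) = there (here refl)
    complete (inj₁ (e-vx (suc i) _)) = ∈-neighbours (z₃ ∷ z₄ ∷ []) (x ∘ suc) i
    sound : ∀ {b} → b ∈ (z₃ ∷ z₄ ∷ []) ++ map (x ∘ suc) (allFin (2 + k)) → v ~ b
    sound (here refl) = inj₁ e-vz₃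
    sound (there (here refl)) = inj₁ e-vz₄
    sound (there (there b∈)) with i , refl ← ∈-tabulate⁻ (x ∘ suc) b∈ = inj₁ (e-vx (suc i) (s≤s z≤n))

  degree-z₁ : HasDegree r z₁ r
  degree-z₁ = HasDegree-fromList (z₁' ∷ z₂ ∷ []) x (((λ ()) ∷ []) ∷ [] ∷ []) (λ _ → (λ ()) ∷ (λ ()) ∷ [])
    x-injective complete sound
    where
    complete : ∀ {b} → z₁ ~ b → b ∈ (z₁' ∷ z₂ ∷ []) ++ map x (allFin (3 + k))
    complete (inj₁ e-z₁z₁') = here refl
    complete (inj₁ e-z₁z₂) = there (here refl)
    complete (inj₁ (e-z₁x i)) = ∈-neighbours (z₁' ∷ z₂ ∷ []) x i
    sound : ∀ {b} → b ∈ (z₁' ∷ z₂ ∷ []) ++ map x (allFin (3 + k)) → z₁ ~ b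
    sound (here refl) = inj₁ e-z₁z₁'
    sound (there (here refl)) = inj₁ e-z₁z₂
    sound (there (there b∈)) with i , refl ← ∈-tabulate⁻ x b∈ = inj₁ (e-z₁x i)

  degree-z₂ : HasDegree r z₂ r
  degree-z₂ = HasDegree-fromList (z₁ ∷ z₃ ∷ z₄ ∷ []) (x ∘ inject₁)
    (((λ ()) ∷ (λ ()) ∷ []) ∷ ((λ ()) ∷ []) ∷ [] ∷ []) (λ _ → (λ ()) ∷ (λ ()) ∷ (λ ()) ∷ [])
    (Fin.inject₁-injective ∘ x-injective) complete sound
    where
    complete : ∀ {b} → z₂ ~ b → b ∈ (z₁ ∷ z₃ ∷ z₄ ∷ []) ++ map (x ∘ inject₁) (allFin (2 + k))
    complete (inj₁ e-z₂z₃) = there (here refl)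
    complete (inj₁ e-z₂z₄) = there (there (here refl))
    complete (inj₁ (e-z₂x i lt)) =
      subst (_∈ (z₁ ∷ z₃ ∷ z₄ ∷ []) ++ map (x ∘ inject₁) (allFin (2 + k))) (cong x (Fin.inject₁-lower₁ i i≢)) (∈-neighbours (z₁ ∷ z₃ ∷ z₄ ∷ []) (x ∘ inject₁) (lower₁ i i≢))
      where
      i≢ : 2 + k ≢ toℕ i
      i≢ e = ℕ.<-irrefl (sym e) lt
    complete (inj₂ e-z₁z₂) = here refl
    sound : ∀ {b} → b ∈ (z₁ ∷ z₃ ∷ z₄ ∷ []) ++ map (x ∘ inject₁) (allFin (2 + k)) → z₂ ~ b
    sound (here refl) = inj₂ e-z₁z₂
    sound (there (here refl)) = inj₁ e-z₂z₃
    sound (there (there (here refl))) = inj₁ e-z₂z₄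
    sound (there (there (there b∈))) with i , refl ← ∈-tabulate⁻ (x ∘ inject₁) b∈ =
      inj₁ (e-z₂x (inject₁ i) (subst (_< 2 + k) (sym (Fin.toℕ-inject₁ i)) (Fin.toℕ<n i)))

  degree-z₃ : HasDegree r z₃ r
  degree-z₃ = HasDegree-fromList (v ∷ z₂ ∷ z₄ ∷ x₁ ∷ []) y
    (((λ ()) ∷ (λ ()) ∷ (λ ()) ∷ []) ∷ ((λ ()) ∷ (λ ()) ∷ []) ∷ ((λ ()) ∷ []) ∷ [] ∷ [])
    (λ _ → (λ ()) ∷ (λ ()) ∷ (λ ()) ∷ (λ ()) ∷ []) y-injective complete sound
    where
    complete : ∀ {b} → z₃ ~ b → b ∈ (v ∷ z₂ ∷ z₄ ∷ x₁ ∷ []) ++ map y (allFin (1 + k))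
    complete (inj₁ e-z₃z₄) = there (there (here refl))
    complete (inj₁ (e-z₃x₁ i e)) = there (there (there (here (cong x (Fin.toℕ-injective e)))))
    complete (inj₁ (e-z₃y j)) = ∈-neighbours (v ∷ z₂ ∷ z₄ ∷ x₁ ∷ []) y j
    complete (inj₂ e-vz₃) = here refl
    complete (inj₂ e-z₂z₃) = there (here refl)
    sound : ∀ {b} → b ∈ (v ∷ z₂ ∷ z₄ ∷ x₁ ∷ []) ++ map y (allFin (1 + k)) → z₃ ~ b
    sound (here refl) = inj₂ e-vz₃
    sound (there (here refl)) = inj₂ e-z₂z₃
    sound (there (there (here refl))) = inj₁ e-z₃z₄
    sound (there (there (there (here refl)))) = z₃~x₁
    sound (there (there (there (there b∈)))) with j , refl ← ∈-tabulate⁻ y b∈ = inj₁ (e-z₃y j)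

  degree-z₄ : HasDegree r z₄ r
  degree-z₄ = HasDegree-fromList (v ∷ z₂ ∷ z₃ ∷ xᵣ₋₂ ∷ []) y
    (((λ ()) ∷ (λ ()) ∷ (λ ()) ∷ []) ∷ ((λ ()) ∷ (λ ()) ∷ []) ∷ ((λ ()) ∷ []) ∷ [] ∷ [])
    (λ _ → (λ ()) ∷ (λ ()) ∷ (λ ()) ∷ (λ ()) ∷ []) y-injective complete sound
    where
    complete : ∀ {b} → z₄ ~ b → b ∈ (v ∷ z₂ ∷ z₃ ∷ xᵣ₋₂ ∷ []) ++ map y (allFin (1 + k))
    complete (inj₁ (e-z₄x i e)) =
      there (there (there (here (cong x (Fin.toℕ-injective (trans e (sym (Fin.toℕ-fromℕ (2 + k)))))))))
    complete (inj₁ (e-z₄y j)) = ∈-neighbours (v ∷ z₂ ∷ z₃ ∷ xᵣ₋₂ ∷ []) y j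
    complete (inj₂ e-vz₄) = here refl
    complete (inj₂ e-z₂z₄) = there (here refl)
    complete (inj₂ e-z₃z₄) = there (there (here refl))
    sound : ∀ {b} → b ∈ (v ∷ z₂ ∷ z₃ ∷ xᵣ₋₂ ∷ []) ++ map y (allFin (1 + k)) → z₄ ~ b
    sound (here refl) = inj₂ e-vz₄
    sound (there (here refl)) = inj₂ e-z₂z₄
    sound (there (there (here refl))) = inj₂ e-z₃z₄
    sound (there (there (there (here refl)))) = z₄~xᵣ₋₂
    sound (there (there (there (there b∈)))) with j , refl ← ∈-tabulate⁻ y b∈ = inj₁ (e-z₄y j)

  degree-u' : HasDegree r u' r
  degree-u' = HasDegree-fromList (u ∷ []) t ([] ∷ []) (λ _ → (λ ()) ∷ []) t-injective complete sound
    where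
    complete : ∀ {b} → u' ~ b → b ∈ (u ∷ []) ++ map t (allFin (4 + k))
    complete (inj₁ (e-u't l)) = ∈-neighbours (u ∷ []) t l
    complete (inj₂ e-uu') = here refl
    sound : ∀ {b} → b ∈ (u ∷ []) ++ map t (allFin (4 + k)) → u' ~ b
    sound (here refl) = inj₂ e-uu'
    sound (there b∈) with l , refl ← ∈-tabulate⁻ t b∈ = inj₁ (e-u't l)

  degree-z₁' : HasDegree r z₁' r
  degree-z₁' = HasDegree-fromList (z₁ ∷ []) t ([] ∷ []) (λ _ → (λ ()) ∷ []) t-injective complete sound
    where
    complete : ∀ {b} → z₁' ~ b → b ∈ (z₁ ∷ []) ++ map t (allFin (4 + k))
    complete (inj₁ (e-z₁'t l)) = ∈-neighbours (z₁ ∷ []) t l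
    complete (inj₂ e-z₁z₁') = here refl
    sound : ∀ {b} → b ∈ (z₁ ∷ []) ++ map t (allFin (4 + k)) → z₁' ~ b
    sound (here refl) = inj₂ e-z₁z₁'
    sound (there b∈) with l , refl ← ∈-tabulate⁻ t b∈ = inj₁ (e-z₁'t l)

  degree-y : ∀ j → HasDegree r (y j) r
  degree-y j = HasDegree-fromList (z₃ ∷ z₄ ∷ []) x (((λ ()) ∷ []) ∷ [] ∷ []) (λ _ → (λ ()) ∷ (λ ()) ∷ [])
    x-injective complete sound
    where
    complete : ∀ {b} → y j ~ b → b ∈ (z₃ ∷ z₄ ∷ []) ++ map x (allFin (3 + k))
    complete (inj₂ (e-z₃y _)) = here refl
    complete (inj₂ (e-z₄y _)) = there (here refl)
    complete (inj₂ (e-xy i _)) = ∈-neighbours (z₃ ∷ z₄ ∷ []) x i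
    sound : ∀ {b} → b ∈ (z₃ ∷ z₄ ∷ []) ++ map x (allFin (3 + k)) → y j ~ b
    sound (here refl) = inj₂ (e-z₃y j)
    sound (there (here refl)) = inj₂ (e-z₄y j)
    sound (there (there b∈)) with i , refl ← ∈-tabulate⁻ x b∈ = inj₂ (e-xy i j)

  degree-t : ∀ l → HasDegree r (t l) r
  degree-t l = HasDegree-fromList (u' ∷ z₁' ∷ []) (t ∘ punchIn l) (((λ ()) ∷ []) ∷ [] ∷ [])
    (λ _ → (λ ()) ∷ (λ ()) ∷ []) (Fin.punchIn-injective l _ _ ∘ t-injective) complete sound
    where
    others : List V
    others = (u' ∷ z₁' ∷ []) ++ map (t ∘ punchIn l) (allFin (3 + k))
    t∈others : ∀ {l'} → l ≢ l' → t l' ∈ others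
    t∈others l≢l' = subst (_∈ others) (cong t (Fin.punchIn-punchOut l≢l'))
      (∈-neighbours (u' ∷ z₁' ∷ []) (t ∘ punchIn l) (punchOut l≢l'))
    complete : ∀ {b} → t l ~ b → b ∈ others
    complete (inj₁ (e-tt _ _ lt)) = t∈others (λ e → ℕ.<-irrefl (cong toℕ e) lt)
    complete (inj₂ (e-u't _)) = here refl
    complete (inj₂ (e-z₁'t _)) = there (here refl)
    complete (inj₂ (e-tt _ _ lt)) = t∈others (λ e → ℕ.<-irrefl (cong toℕ (sym e)) lt)
    sound : ∀ {b} → b ∈ others → t l ~ b
    sound (here refl) = inj₂ (e-u't l)
    sound (there (here refl)) = inj₂ (e-z₁'t l)
    sound (there (there b∈)) with i , refl ← ∈-tabulate⁻ (t ∘ punchIn l) b∈ =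
      t~t l (punchIn l i) (Fin.punchInᵢ≢i l i ∘ sym)

  degree-x₁ : HasDegree r x₁ r
  degree-x₁ = HasDegree-fromList (u ∷ z₁ ∷ z₂ ∷ z₃ ∷ []) y
    (((λ ()) ∷ (λ ()) ∷ (λ ()) ∷ []) ∷ ((λ ()) ∷ (λ ()) ∷ []) ∷ ((λ ()) ∷ []) ∷ [] ∷ [])
    (λ _ → (λ ()) ∷ (λ ()) ∷ (λ ()) ∷ (λ ()) ∷ []) y-injective complete sound
    where
    complete : ∀ {b} → x₁ ~ b → b ∈ (u ∷ z₁ ∷ z₂ ∷ z₃ ∷ []) ++ map y (allFin (1 + k))
    complete (inj₁ (e-xy _ j)) = ∈-neighbours (u ∷ z₁ ∷ z₂ ∷ z₃ ∷ []) y j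
    complete (inj₂ (e-ux _)) = here refl
    complete (inj₂ (e-z₁x _)) = there (here refl)
    complete (inj₂ (e-z₂x _ _)) = there (there (here refl))
    complete (inj₂ (e-z₃x₁ _ _)) = there (there (there (here refl)))
    sound : ∀ {b} → b ∈ (u ∷ z₁ ∷ z₂ ∷ z₃ ∷ []) ++ map y (allFin (1 + k)) → x₁ ~ b
    sound (here refl) = inj₂ (e-ux zero)
    sound (there (here refl)) = inj₂ (e-z₁x zero)
    sound (there (there (here refl))) = ~-sym z₂~x₁
    sound (there (there (there (here refl)))) = ~-sym z₃~x₁
    sound (there (there (there (there b∈)))) with j , refl ← ∈-tabulate⁻ y b∈ = inj₁ (e-xy zero j)

  degree-xᵣ₋₂ : HasDegree r xᵣ₋₂ r
  degree-xᵣ₋₂ = HasDegree-fromList (u ∷ z₁ ∷ v ∷ z₄ ∷ []) y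
    (((λ ()) ∷ (λ ()) ∷ (λ ()) ∷ []) ∷ ((λ ()) ∷ (λ ()) ∷ []) ∷ ((λ ()) ∷ []) ∷ [] ∷ [])
    (λ _ → (λ ()) ∷ (λ ()) ∷ (λ ()) ∷ (λ ()) ∷ []) y-injective complete sound
    where
    complete : ∀ {b} → xᵣ₋₂ ~ b → b ∈ (u ∷ z₁ ∷ v ∷ z₄ ∷ []) ++ map y (allFin (1 + k))
    complete (inj₁ (e-xy _ j)) = ∈-neighbours (u ∷ z₁ ∷ v ∷ z₄ ∷ []) y j
    complete (inj₂ (e-ux _)) = here refl
    complete (inj₂ (e-vx _ _)) = there (there (here refl))
    complete (inj₂ (e-z₁x _)) = there (here refl)
    complete (inj₂ (e-z₂x _ lt)) = ⊥-elim (¬z₂~xᵣ₋₂ (inj₁ (e-z₂x _ lt)))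
    complete (inj₂ (e-z₄x _ _)) = there (there (there (here refl)))
    sound : ∀ {b} → b ∈ (u ∷ z₁ ∷ v ∷ z₄ ∷ []) ++ map y (allFin (1 + k)) → xᵣ₋₂ ~ b
    sound (here refl) = inj₂ (e-ux _)
    sound (there (here refl)) = inj₂ (e-z₁x _)
    sound (there (there (here refl))) = xᵣ₋₂~v
    sound (there (there (there (here refl)))) = ~-sym z₄~xᵣ₋₂
    sound (there (there (there (there b∈)))) with j , refl ← ∈-tabulate⁻ y b∈ = inj₁ (e-xy _ j)

  degree-inner : ∀ j₀ → HasDegree r (inner j₀) r
  degree-inner j₀ = HasDegree-fromList (u ∷ z₁ ∷ v ∷ z₂ ∷ []) y
    (((λ ()) ∷ (λ ()) ∷ (λ ()) ∷ []) ∷ ((λ ()) ∷ (λ ()) ∷ []) ∷ ((λ ()) ∷ []) ∷ [] ∷ [])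
    (λ _ → (λ ()) ∷ (λ ()) ∷ (λ ()) ∷ (λ ()) ∷ []) y-injective complete sound
    where
    complete : ∀ {b} → inner j₀ ~ b → b ∈ (u ∷ z₁ ∷ v ∷ z₂ ∷ []) ++ map y (allFin (1 + k))
    complete (inj₁ (e-xy _ j)) = ∈-neighbours (u ∷ z₁ ∷ v ∷ z₂ ∷ []) y j
    complete (inj₂ (e-ux _)) = here refl
    complete (inj₂ (e-vx _ _)) = there (there (here refl))
    complete (inj₂ (e-z₁x _)) = there (here refl)
    complete (inj₂ (e-z₂x _ _)) = there (there (there (here refl)))
    complete (inj₂ (e-z₄x _ e)) = ⊥-elim (Fin.toℕ-inject₁-≢ j₀ (sym (ℕ.suc-injective e)))
    sound : ∀ {b} → b ∈ (u ∷ z₁ ∷ v ∷ z₂ ∷ []) ++ map y (allFin (1 + k)) → inner j₀ ~ b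
    sound (here refl) = inj₂ (e-ux _)
    sound (there (here refl)) = inj₂ (e-z₁x _)
    sound (there (there (here refl))) = inner~v (j₀ , refl)
    sound (there (there (there (here refl)))) = ~-sym (z₂~inner (j₀ , refl))
    sound (there (there (there (there b∈)))) with j , refl ← ∈-tabulate⁻ y b∈ = inj₁ (e-xy _ j)

  degree-x : ∀ i → HasDegree r (x i) r
  degree-x i with x-view i
  ... | is-first = degree-x₁
  ... | is-last = degree-xᵣ₋₂
  ... | is-inner j = degree-inner j

  degree-other : ∀ w → w ≢ u → w ≢ v → HasDegree r w r
  degree-other u w≢u _ = ⊥-elim (w≢u refl)
  degree-other v _ w≢v = ⊥-elim (w≢v refl)
  degree-other z₁ _ _ = degree-z₁
  degree-other z₂ _ _ = degree-z₂
  degree-other z₃ _ _ = degree-z₃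
  degree-other z₄ _ _ = degree-z₄
  degree-other u' _ _ = degree-u'
  degree-other z₁' _ _ = degree-z₁'
  degree-other (x i) _ _ = degree-x i
  degree-other (y j) _ _ = degree-y j
  degree-other (t l) _ _ = degree-t l

module Parametrisation (k : ℕ) where
  open Graph k
  open OrderAndDegrees k

  HamUVPathVia : List V → Set
  HamUVPathVia p = HamUVPath r p × UsesEdge z₁ z₂ p

  -- After z₂ the path alternates between inner x's and y's, n pairs at a time, around a middle block:
  -- either x₁z₃z₄x_{r−2} with 0 ≤ n ≤ r−4, or x_{r−2}z₄z₃x₁ with 1 ≤ n ≤ r−5 (as z₂x_{r−2} and x₁v
  -- are not edges, neither alternating block may be empty then). This gives (r−3) + (r−5) = 2r−8.
  Crossing : Set
  Crossing = Fin (2 + k) ⊎ Fin k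

  split : Crossing → ℕ
  split (inj₁ i) = toℕ i
  split (inj₂ j) = suc (toℕ j)

  end : Crossing → V
  end (inj₁ _) = x₁
  end (inj₂ _) = xᵣ₋₂

  inside : Crossing → List V
  inside (inj₁ _) = z₃ ∷ z₄ ∷ xᵣ₋₂ ∷ []
  inside (inj₂ _) = z₄ ∷ z₃ ∷ x₁ ∷ []

  middle : Crossing → List V
  middle c = end c ∷ inside c

  pathTail : Crossing → List V → List V → List V
  pathTail c α β = weave (split c) α β (middle c) ++ v ∷ []

  Parameters : Set
  Parameters = List V × Crossing × List V × List V

  Valid : Parameters → Set
  Valid = Arrangement ts ⟨×⟩ (U ⟨⊎⟩ U) ⟨×⟩ Arrangement inners ⟨×⟩ Arrangement ys

  path : Parameters → List V
  path (π , c , α , β) = u ∷ u' ∷ π ++ z₁' ∷ z₁ ∷ z₂ ∷ pathTail c α β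

  split≤ : ∀ c → split c ≤ 1 + k
  split≤ (inj₁ i) = ℕ.≤-pred (Fin.toℕ<n i)
  split≤ (inj₂ j) = s≤s (ℕ.<⇒≤ (Fin.toℕ<n j))

  split≤length : ∀ {α} → Arrangement inners α → ∀ c → split c ≤ length α
  split≤length α-arr c = subst (split c ≤_) (sym (Arrangement-tabulate-length Unique-inners α-arr)) (split≤ c)

  ⊆-middle : ∀ c → x₁ ∷ xᵣ₋₂ ∷ z₃ ∷ z₄ ∷ [] ⊆ middle c
  ⊆-middle (inj₁ _) (here refl) = here refl
  ⊆-middle (inj₁ _) (there (here refl)) = there (there (there (here refl)))
  ⊆-middle (inj₁ _) (there (there (here refl))) = there (here refl)
  ⊆-middle (inj₁ _) (there (there (there (here refl)))) = there (there (here refl))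
  ⊆-middle (inj₂ _) (here refl) = there (there (there (here refl)))
  ⊆-middle (inj₂ _) (there (here refl)) = here refl
  ⊆-middle (inj₂ _) (there (there (here refl))) = there (there (here refl))
  ⊆-middle (inj₂ _) (there (there (there (here refl)))) = there (here refl)

  open Alternating {P = IsInner} {Q = IsY} (x~y ∘ inner⇒IsX) (λ q → y~x q ∘ inner⇒IsX)
    renaming (Linked-interleave to Linked-inner-y; Linked-interleave⁺ to Linked-inner-y⁺)
  open Alternating {P = IsY} {Q = IsInner} (λ q → y~x q ∘ inner⇒IsX) (x~y ∘ inner⇒IsX)
    renaming (Linked-interleave to Linked-y-inner; Linked-interleave⁺ to Linked-y-inner⁺)

  module _ {α β} (α-arr : Arrangement inners α) (β-arr : Arrangement ys β) where

    length-α : length α ≡ 1 + k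
    length-α = Arrangement-tabulate-length Unique-inners α-arr

    α≡β : length α ≡ length β
    α≡β = trans length-α (sym (Arrangement-tabulate-length Unique-ys β-arr))

    inner-α : All IsInner α
    inner-α = Arrangement-tabulate-All (λ j → j , refl) α-arr

    y-β : All IsY β
    y-β = Arrangement-tabulate-All (λ j → j , refl) β-arr

    Linked-pathTail : ∀ c → Linked _~_ (z₂ ∷ pathTail c α β)
    Linked-pathTail c@(inj₁ i) =
      subst (Linked _~_ ∘ (z₂ ∷_)) (sym (List.++-assoc (interleave (take n α) (take n β)) _ (v ∷ [])))
        (Linked-inner-y (length-take≡ {α = α} {β} α≡β n) (All-take n inner-α) (All-take n y-β)
          z₂~inner z₂~x₁ (λ q → y~x q (_ , refl))
          (~-sym z₃~x₁ ∷ inj₁ e-z₃z₄ ∷ z₄~xᵣ₋₂ ∷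
            Linked-y-inner (length-drop≡ {α = α} {β} α≡β n) (All-drop n y-β) (All-drop n inner-α)
              (x~y (_ , refl)) xᵣ₋₂~v inner~v [-]))
      where n = split c
    Linked-pathTail c@(inj₂ j) =
      subst (Linked _~_ ∘ (z₂ ∷_)) (sym (List.++-assoc (interleave (take n α) (take n β)) _ (v ∷ [])))
        (Linked-inner-y⁺ take-nonempty (length-take≡ {α = α} {β} α≡β n) (All-take n inner-α) (All-take n y-β)
          z₂~inner (λ q → y~x q (_ , refl))
          (~-sym z₄~xᵣ₋₂ ∷ inj₂ e-z₃z₄ ∷ z₃~x₁ ∷
            Linked-y-inner⁺ drop-nonempty (length-drop≡ {α = α} {β} α≡β n) (All-drop n y-β) (All-drop n inner-α)
              (x~y (_ , refl)) inner~v [-]))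
      where
      n = split c
      take-nonempty : 0 < length (take n α)
      take-nonempty = subst (0 <_) (sym (length-take-≤ n α (split≤length α-arr c))) (s≤s z≤n)
      drop-nonempty : 0 < length (drop n β)
      drop-nonempty = subst (0 <_) (sym (trans (List.length-drop n β) (cong (_∸ n) (trans (sym α≡β) length-α))))
        (ℕ.m<n⇒0<n∸m (Fin.toℕ<n j))

    ⊆-pathTail : ∀ c → α ++ β ++ middle c ⊆ pathTail c α β
    ⊆-pathTail c = ∈-++⁺ˡ ∘ ⊆-weave {α = α} {β} α≡β (split c)

    length-pathTail : ∀ c → length (pathTail c α β) ≡ 7 + (k + k)
    length-pathTail c = begin
      length (weave (split c) α β (middle c) ++ v ∷ [])
        ≡⟨ List.length-++ (weave (split c) α β (middle c)) ⟩
      length (weave (split c) α β (middle c)) + 1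
        ≡⟨ cong (_+ 1) (length-weave {α = α} {β} α≡β (split c) (middle c)) ⟩
      length α + length α + length (middle c) + 1
        ≡⟨ cong₂ (λ a m → a + a + m + 1) length-α (length-middle c) ⟩
      (1 + k) + (1 + k) + 4 + 1
        ≡⟨ arithmetic k ⟩
      7 + (k + k)
        ∎
      where
      open ≡-Reasoning
      length-middle : ∀ c → length (middle c) ≡ 4
      length-middle (inj₁ _) = refl
      length-middle (inj₂ _) = refl
      arithmetic : ∀ k → (1 + k) + (1 + k) + 4 + 1 ≡ 7 + (k + k)
      arithmetic = solve-∀

  Linked-ts : ∀ {l π rest} → Unique (t l ∷ π) → All IsT π → Linked _~_ (z₁' ∷ rest) →
    Linked _~_ (t l ∷ π ++ z₁' ∷ rest)
  Linked-ts {l} {[]} _ _ rs = inj₂ (e-z₁'t l) ∷ rs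
  Linked-ts {l} {_ ∷ π} (t∉ ∷ π!) ((l' , refl) ∷ ts) rs =
    t~t l l' (λ { refl → All.lookup t∉ (here refl) refl }) ∷ Linked-ts π! ts rs

  Linked-clique : ∀ {π rest} → Arrangement ts π → Linked _~_ (z₁' ∷ rest) → Linked _~_ (u' ∷ π ++ z₁' ∷ rest)
  Linked-clique {[]} (_ , _ , ts⊆) _ with () ← ts⊆ (∈-tabulate⁺ t zero)
  Linked-clique {_ ∷ _} π-arr@(π! , _) rs with (l , refl) ∷ ts ← Arrangement-tabulate-All {P = IsT} (λ l → l , refl) π-arr =
    inj₁ (e-u't l) ∷ Linked-ts π! ts rs

  module _ {π : List V} {c : Crossing} {α β : List V} (valid : Valid (π , c , α , β)) where

    private
      π-arr = proj₁ valid
      α-arr = proj₁ (proj₂ (proj₂ valid))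
      β-arr = proj₂ (proj₂ (proj₂ valid))

      pathTail⊆path : pathTail c α β ⊆ path (π , c , α , β)
      pathTail⊆path w∈ = there (there (∈-++⁺ʳ π (there (there (there w∈)))))

      middle⊆path : x₁ ∷ xᵣ₋₂ ∷ z₃ ∷ z₄ ∷ [] ⊆ path (π , c , α , β)
      middle⊆path = pathTail⊆path ∘ ⊆-pathTail α-arr β-arr c ∘ ∈-++⁺ʳ α ∘ ∈-++⁺ʳ β ∘ ⊆-middle c

    ∈-path : ∀ w → w ∈ path (π , c , α , β)
    ∈-path u = here refl
    ∈-path u' = there (here refl)
    ∈-path z₁' = there (there (∈-++⁺ʳ π (here refl)))
    ∈-path z₁ = there (there (∈-++⁺ʳ π (there (here refl))))
    ∈-path z₂ = there (there (∈-++⁺ʳ π (there (there (here refl)))))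
    ∈-path (t l) = there (there (∈-++⁺ˡ (proj₂ (proj₂ π-arr) (∈-tabulate⁺ t l))))
    ∈-path v = pathTail⊆path (∈-++⁺ʳ (weave (split c) α β (middle c)) (here refl))
    ∈-path z₃ = middle⊆path (there (there (here refl)))
    ∈-path z₄ = middle⊆path (there (there (there (here refl))))
    ∈-path (y j) = pathTail⊆path (⊆-pathTail α-arr β-arr c (∈-++⁺ʳ α (∈-++⁺ˡ (proj₂ (proj₂ β-arr) (∈-tabulate⁺ y j)))))
    ∈-path (x i) = ∈-x (x-view i)
      where
      ∈-x : ∀ {i} → XView i → x i ∈ path (π , c , α , β)
      ∈-x is-first = middle⊆path (here refl)
      ∈-x is-last = middle⊆path (there (here refl))
      ∈-x (is-inner j) = pathTail⊆path (⊆-pathTail α-arr β-arr c (∈-++⁺ˡ (proj₂ (proj₂ α-arr) (∈-tabulate⁺ inner j))))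

    length-path : length (path (π , c , α , β)) ≡ 3 * r + 1
    length-path = begin
      2 + length (π ++ z₁' ∷ z₁ ∷ z₂ ∷ pathTail c α β)
        ≡⟨ cong (2 +_) (List.length-++ π) ⟩
      2 + (length π + (3 + length (pathTail c α β)))
        ≡⟨ cong₂ (λ a b → 2 + (a + (3 + b))) (Arrangement-tabulate-length Unique-ts π-arr)
                                            (length-pathTail α-arr β-arr c) ⟩
      2 + ((4 + k) + (3 + (7 + (k + k))))
        ≡⟨ arithmetic k ⟩
      3 * r + 1
        ∎
      where
      open ≡-Reasoning
      arithmetic : ∀ k → 2 + ((4 + k) + (3 + (7 + (k + k)))) ≡ 3 * (5 + k) + 1
      arithmetic = solve-∀

    path-HamUVPathVia : HamUVPathVia (path (π , c , α , β))
    path-HamUVPathVia = (refl , last-path , Linked-path , Unique-path , ∈-path) , uses-z₁z₂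
      where
      last-path : last (path (π , c , α , β)) ≡ just v
      last-path = begin
        last (u ∷ u' ∷ π ++ z₁' ∷ z₁ ∷ z₂ ∷ W ++ v ∷ [])
          ≡⟨ last-++-∷ (u ∷ u' ∷ π) (z₁ ∷ z₂ ∷ W ++ v ∷ []) ⟩
        last (z₁' ∷ z₁ ∷ z₂ ∷ W ++ v ∷ [])
          ≡⟨ last-++-∷ (z₁' ∷ z₁ ∷ z₂ ∷ W) [] ⟩
        just v
          ∎
        where
        open ≡-Reasoning
        W = weave (split c) α β (middle c)
      Linked-path : Linked _~_ (path (π , c , α , β))
      Linked-path = inj₁ e-uu' ∷ Linked-clique π-arr (inj₂ e-z₁z₁' ∷ inj₁ e-z₁z₂ ∷ Linked-pathTail α-arr β-arr c)
      -- The path visits all 3r+1 vertices and has 3r+1 entries, so it has no repetitions.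
      Unique-path : Unique (path (π , c , α , β))
      Unique-path = Unique-⊆-length vertices Unique-vertices (λ {w} _ → ∈-path w)
        (ℕ.≤-reflexive (trans length-path (sym length-vertices)))
      uses-z₁z₂ : UsesEdge z₁ z₂ (path (π , c , α , β))
      uses-z₁z₂ = u ∷ u' ∷ π ++ z₁' ∷ [] , pathTail c α β ,
        inj₁ (cong (λ l → u ∷ u' ∷ l) (sym (List.++-assoc π (z₁' ∷ []) (z₁ ∷ z₂ ∷ pathTail c α β))))

  IsEnd : V → Set
  IsEnd w = w ≡ x₁ ⊎ w ≡ xᵣ₋₂

  end-IsEnd : ∀ c → IsEnd (end c)
  end-IsEnd (inj₁ _) = inj₁ refl
  end-IsEnd (inj₂ _) = inj₂ refl

  inner-¬IsEnd : ∀ {w} → IsInner w → ¬ IsEnd w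
  inner-¬IsEnd (j , refl) (inj₁ e) = inner≢x₁ j e
  inner-¬IsEnd (j , refl) (inj₂ e) = inner≢xᵣ₋₂ j e

  y-¬IsEnd : ∀ {w} → IsY w → ¬ IsEnd w
  y-¬IsEnd (_ , refl) (inj₁ ())
  y-¬IsEnd (_ , refl) (inj₂ ())

  length-inside : ∀ c c' → length (inside c) ≡ length (inside c')
  length-inside (inj₁ _) (inj₁ _) = refl
  length-inside (inj₁ _) (inj₂ _) = refl
  length-inside (inj₂ _) (inj₁ _) = refl
  length-inside (inj₂ _) (inj₂ _) = refl

  crossing-injective : ∀ c c' → split c ≡ split c' → end c ≡ end c' → c ≡ c'
  crossing-injective (inj₁ i) (inj₁ i') e _ = cong inj₁ (Fin.toℕ-injective e)
  crossing-injective (inj₂ j) (inj₂ j') e _ = cong inj₂ (Fin.toℕ-injective (ℕ.suc-injective e))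

  z₁'∉ : ∀ {π} → Arrangement ts π → z₁' ∉ π
  z₁'∉ (_ , π⊆ , _) z₁'∈ with () ← proj₂ (∈-tabulate⁻ t (π⊆ z₁'∈))

  path-injective : ∀ {ps ps'} → Valid ps → Valid ps' → path ps ≡ path ps' → ps ≡ ps'
  path-injective {π , c , α , β} {π' , c' , α' , β'} (π-arr , _ , α-arr , β-arr) (π'-arr , _ , α'-arr , β'-arr) e
    with refl , tails ← ++-∷-injective π (z₁'∉ π-arr) (z₁'∉ π'-arr) (cong (drop 2) e)
    with split≡ , refl , refl , end≡ , _ ←
           weave-injective {Q = IsEnd} (split c) (split c')
             (α≡β α-arr β-arr) (α≡β α'-arr β'-arr) (split≤length α-arr c) (split≤length α'-arr c')
             (All.map inner-¬IsEnd (inner-α α-arr β-arr)) (All.map y-¬IsEnd (y-β α-arr β-arr))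
             (All.map inner-¬IsEnd (inner-α α'-arr β'-arr)) (All.map y-¬IsEnd (y-β α'-arr β'-arr))
             (end-IsEnd c) (end-IsEnd c') (length-inside c c')
             (List.++-cancelʳ (v ∷ []) _ _ (cong (drop 2) tails))
    = cong (λ c → π , c , α , β) (crossing-injective c c' split≡ end≡)

module Surjectivity (k : ℕ) where
  open Graph k
  open Parametrisation k

  ∈-∷-suffix : ∀ {w} xs {a : V} {ys} → last (xs ++ a ∷ ys) ≡ just w → w ∈ a ∷ ys
  ∈-∷-suffix xs {ys = ys} eq = last-∈ _ (trans (sym (last-++-∷ xs ys)) eq)

  enter-clique : ∀ {a M w} → ¬ InClique a → Linked _~_ (a ∷ M) → w ∈ M → InClique w →
    ∃ λ L → ∃ λ N → (a ∷ M ≡ L ++ u ∷ u' ∷ N) ⊎ (a ∷ M ≡ L ++ z₁ ∷ z₁' ∷ N)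
  enter-clique ¬ca lnk w∈ cw
    with L , b , c , N , eq , _ , ¬cb , ¬¬cc ← first-exit (¬? ∘ InClique?) ¬ca (Any.map (λ { refl → λ ¬cw → ¬cw cw }) w∈)
    with clique-boundary (Linked-++-∷⁻ L (subst (Linked _~_) eq lnk)) ¬cb (decidable-stable (InClique? c) ¬¬cc)
  ... | inj₁ (refl , refl) = L , N , inj₁ eq
  ... | inj₂ (refl , refl) = L , N , inj₂ eq

  leave-clique : ∀ {c M} → InClique c → Linked _~_ (c ∷ M) → v ∈ M →
    ∃ λ D → ∃ λ N → All InClique D × ((c ∷ M ≡ D ++ u' ∷ u ∷ N) ⊎ (c ∷ M ≡ D ++ z₁' ∷ z₁ ∷ N))
  leave-clique cc lnk v∈
    with D , c' , a , N , eq , all , cc' , ¬ca ← first-exit InClique? cc (Any.map (λ { refl () }) v∈)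
    with clique-boundary (~-sym (Linked-++-∷⁻ D (subst (Linked _~_) eq lnk))) ¬ca cc'
  ... | inj₁ (refl , refl) = D , N , all , inj₁ eq
  ... | inj₂ (refl , refl) = D , N , all , inj₂ eq

  -- K is entered through uu' (after z₁z₁' it could only be left through an already visited vertex),
  -- left through z₁'z₁ and never re-entered.
  clique-block : ∀ {q} → Unique (u ∷ q) → Linked _~_ (u ∷ q) → last (u ∷ q) ≡ just v → u' ∈ q →
    ∃ λ π → ∃ λ B → q ≡ u' ∷ π ++ z₁' ∷ z₁ ∷ B × All InClique π × All (¬_ ∘ InClique) B
  clique-block {q} q!@(u∉ ∷ _) lnk last≡ u'∈ with enter-clique (λ ()) lnk u'∈ u'∈K
  ... | _ ∷ L , _ , inj₁ eq = ⊥-elim (All.lookup u∉ (∈-split L (List.∷-injectiveʳ eq)) refl)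
  ... | _ ∷ L , N , inj₂ eq = ⊥-elim (via-z₁ L N (List.∷-injectiveʳ eq))
    where
    via-z₁ : ∀ L N → q ≡ L ++ z₁ ∷ z₁' ∷ N → ⊥
    via-z₁ L N refl with ∈-∷-suffix (u ∷ L) last≡
    ... | there (there v∈N) with leave-clique z₁'∈K (Linked.tail (Linked-++⁻ʳ (u ∷ L) lnk)) v∈N
    ... | D , _ , _ , inj₁ eq = All.lookup u∉ (∈-++⁺ʳ L (there (∈-split-next D eq))) refl
    ... | D , _ , _ , inj₂ eq = Unique-mid∉ L (Unique-∷⁻ q!) (∈-++⁺ʳ L (∈-split-next D eq))
  ... | [] , N , inj₁ refl with ∈-∷-suffix (u ∷ []) last≡
  ...   | there v∈N with leave-clique u'∈K (Linked.tail lnk) v∈N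
  ...     | D , _ , _ , inj₁ eq = ⊥-elim (All.lookup u∉ (∈-split-next D eq) refl)
  ...     | _ ∷ π , B , _ ∷ inπ , inj₂ refl = π , B , refl , inπ , All.tabulate outside
    where
    outside : ∀ {w} → w ∈ B → ¬ InClique w
    outside w∈ cw with enter-clique (λ ()) (Linked.tail (Linked-++⁻ʳ (u ∷ u' ∷ π) lnk)) w∈ cw
    ... | L , _ , inj₁ eq = All.lookup u∉ (∈-++⁺ʳ (u' ∷ π) (there (∈-split L eq))) refl
    ... | L , _ , inj₂ eq = Unique-mid∉ (u' ∷ π) (Unique-∷⁻ q!) (∈-++⁺ʳ (u' ∷ π) (∈-split-next L eq))

  IsXY : V → Set
  IsXY w = IsX w ⊎ IsY w

  nX nY : List V → ℕ
  nX l = length (filter IsX? l)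
  nY l = length (filter IsY? l)

  data Kind : Set where
    kx ky : Kind

  kind : V → Kind
  kind w = if does (IsX? w) then kx else ky

  kind⇒IsX : ∀ {w} → kind w ≡ kx → IsX w
  kind⇒IsX {w} with IsX? w
  ... | yes px = λ _ → px

  lastKind : V → List V → Kind
  lastKind a [] = kind a
  lastKind _ (b ∷ l) = lastKind b l

  data Shape : Set where
    empty : Shape
    ends : Kind → Kind → Shape

  shape : List V → Shape
  shape [] = empty
  shape (a ∷ l) = ends (kind a) (lastKind a l)

  XX : Shape
  XX = ends kx kx

  StartsX EndsX : Shape → Set
  StartsX (ends kx _) = ⊤
  StartsX _ = ⊥
  EndsX (ends _ kx) = ⊤
  EndsX _ = ⊥

  StartsX⇒∷ : ∀ l → StartsX (shape l) → ∃ λ e → ∃ λ l' → l ≡ e ∷ l' × IsX e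
  StartsX⇒∷ (a ∷ l) sx with kind a in eq
  ... | kx = a , l , refl , kind⇒IsX eq

  EndsX⇒∷ʳ : ∀ l → EndsX (shape l) → ∃ λ l' → ∃ λ e → l ≡ l' ++ e ∷ [] × IsX e
  EndsX⇒∷ʳ (a ∷ l) ex with lastKind a l in eq
  ... | kx = go a l eq
    where
    go : ∀ a l → lastKind a l ≡ kx → ∃ λ l' → ∃ λ e → a ∷ l ≡ l' ++ e ∷ [] × IsX e
    go a [] eq = [] , a , refl , kind⇒IsX eq
    go a (b ∷ l) eq with l' , e , eq' , px ← go b l eq = a ∷ l' , e , cong (a ∷_) eq' , px

  XX-segment : ∀ {l} → All IsXY l → Linked _~_ l → shape l ≡ XX →
    ∃ λ as → ∃ λ bs → ∃ λ e → l ≡ interleave as bs ++ e ∷ [] ×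
      All IsX as × All IsY bs × IsX e × length as ≡ length bs
  XX-segment (inj₁ px ∷ []) _ _ = [] , [] , _ , refl , [] , [] , px , refl
  XX-segment (inj₂ (_ , refl) ∷ _) _ ()
  XX-segment (inj₁ px@(_ , refl) ∷ inj₁ px'@(_ , refl) ∷ _) (r ∷ _) _ = ⊥-elim (¬x~x px px' r)
  XX-segment (inj₁ (_ , refl) ∷ inj₂ py@(_ , refl) ∷ inj₂ py'@(_ , refl) ∷ _) (_ ∷ r ∷ _) _ = ⊥-elim (¬y~y py py' r)
  XX-segment (inj₁ px@(_ , refl) ∷ inj₂ py@(_ , refl) ∷ xy@(inj₁ (_ , refl) ∷ _)) (_ ∷ _ ∷ lnk) eq
    with as , bs , e , eq' , all-x , all-y , pe , len ← XX-segment xy lnk eq =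
    _ ∷ as , _ ∷ bs , e , cong (λ l → _ ∷ _ ∷ l) eq' , px ∷ all-x , py ∷ all-y , pe , cong suc len

  ⟦_⟧ : Kind → ℕ
  ⟦ kx ⟧ = 1
  ⟦ ky ⟧ = 0

  excess : Shape → ℕ
  excess empty = 1
  excess (ends a b) = ⟦ a ⟧ + ⟦ b ⟧

  balance : ∀ {l} → All IsXY l → Linked _~_ l → nX l + 1 ≡ nY l + excess (shape l)
  balance [] _ = refl
  balance (inj₁ (_ , refl) ∷ []) _ = refl
  balance (inj₂ (_ , refl) ∷ []) _ = refl
  balance {_ ∷ b ∷ l} (inj₁ (_ , refl) ∷ xy@(inj₂ (_ , refl) ∷ _)) (_ ∷ lnk) =
    trans (cong suc (balance xy lnk)) (sym (ℕ.+-suc (nY (b ∷ l)) ⟦ lastKind b l ⟧))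
  balance {_ ∷ b ∷ l} (inj₂ (_ , refl) ∷ xy@(inj₁ (_ , refl) ∷ _)) (_ ∷ lnk) =
    trans (balance xy lnk) (ℕ.+-suc (nY (b ∷ l)) ⟦ lastKind b l ⟧)
  balance (inj₁ px ∷ inj₁ px' ∷ _) (r ∷ _) = ⊥-elim (¬x~x px px' r)
  balance (inj₂ py ∷ inj₂ py' ∷ _) (r ∷ _) = ⊥-elim (¬y~y py py' r)

  excess≤2 : ∀ s → excess s ≤ 2
  excess≤2 empty = s≤s z≤n
  excess≤2 (ends kx kx) = ℕ.≤-refl
  excess≤2 (ends kx ky) = s≤s z≤n
  excess≤2 (ends ky kx) = s≤s z≤n
  excess≤2 (ends ky ky) = z≤n

  XX-or-excess≤1 : ∀ s → s ≡ XX ⊎ excess s ≤ 1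
  XX-or-excess≤1 empty = inj₂ ℕ.≤-refl
  XX-or-excess≤1 (ends kx kx) = inj₁ refl
  XX-or-excess≤1 (ends kx ky) = inj₂ ℕ.≤-refl
  XX-or-excess≤1 (ends ky kx) = inj₂ ℕ.≤-refl
  XX-or-excess≤1 (ends ky ky) = inj₂ z≤n

  three-segments : ∀ sP sQ sR → excess sP + excess sQ + excess sR ≡ 5 →
    ¬ (EndsX sP × StartsX sQ) → ¬ (EndsX sQ × StartsX sR) → sP ≡ XX × sQ ≡ empty × sR ≡ XX
  three-segments sP sQ sR total PQ QR
    with XX-or-excess≤1 sP | XX-or-excess≤1 sQ | XX-or-excess≤1 sR
  ... | inj₁ refl | inj₁ refl | _ = ⊥-elim (PQ (tt , tt))
  ... | _ | inj₁ refl | inj₁ refl = ⊥-elim (QR (tt , tt))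
  ... | inj₁ refl | inj₂ _ | inj₁ refl = refl , middle-empty sQ total PQ QR , refl
    where
    middle-empty : ∀ sQ → 2 + excess sQ + 2 ≡ 5 → ¬ (⊤ × StartsX sQ) → ¬ (EndsX sQ × ⊤) → sQ ≡ empty
    middle-empty empty _ _ _ = refl
    middle-empty (ends kx _) _ PQ _ = ⊥-elim (PQ (tt , tt))
    middle-empty (ends ky kx) _ _ QR = ⊥-elim (QR (tt , tt))
  ... | inj₂ P≤1 | inj₂ Q≤1 | _ = ⊥-elim (ℕ.<⇒≢ (s≤s (ℕ.+-mono-≤ (ℕ.+-mono-≤ P≤1 Q≤1) (excess≤2 sR))) total)
  ... | inj₂ P≤1 | _ | inj₂ R≤1 = ⊥-elim (ℕ.<⇒≢ (s≤s (ℕ.+-mono-≤ (ℕ.+-mono-≤ P≤1 (excess≤2 sQ)) R≤1)) total)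
  ... | _ | inj₂ Q≤1 | inj₂ R≤1 = ⊥-elim (ℕ.<⇒≢ (s≤s (ℕ.+-mono-≤ (ℕ.+-mono-≤ (excess≤2 sP) Q≤1) R≤1)) total)

  data Middle : V → V → V → V → Set where
    forward  : Middle x₁ z₃ z₄ xᵣ₋₂
    backward : Middle xᵣ₋₂ z₄ z₃ x₁

  x-neighbourˡ : ∀ {na za zb nb} → Middle na za zb nb → ∀ {w} → za ~ w → IsX w → w ≡ na
  x-neighbourˡ forward = z₃-x-neighbour
  x-neighbourˡ backward = z₄-x-neighbour

  x-neighbourʳ : ∀ {na za zb nb} → Middle na za zb nb → ∀ {w} → zb ~ w → IsX w → w ≡ nb
  x-neighbourʳ forward = z₄-x-neighbour
  x-neighbourʳ backward = z₃-x-neighbour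

  ¬IsXY-za : ∀ {na za zb nb} → Middle na za zb nb → ¬ IsXY za
  ¬IsXY-za forward (inj₁ (_ , ()))
  ¬IsXY-za forward (inj₂ (_ , ()))
  ¬IsXY-za backward (inj₁ (_ , ()))
  ¬IsXY-za backward (inj₂ (_ , ()))

  ¬IsXY-zb : ∀ {na za zb nb} → Middle na za zb nb → ¬ IsXY zb
  ¬IsXY-zb forward (inj₁ (_ , ()))
  ¬IsXY-zb forward (inj₂ (_ , ()))
  ¬IsXY-zb backward (inj₁ (_ , ()))
  ¬IsXY-zb backward (inj₂ (_ , ()))

  x-neighbour-once : ∀ {z n} → (∀ {w} → z ~ w → IsX w → w ≡ n) → ∀ A {e e' C} → IsX e → IsX e' →
    Unique (A ++ e ∷ z ∷ e' ∷ C) → Linked _~_ (A ++ e ∷ z ∷ e' ∷ C) → ⊥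
  x-neighbour-once neighbour A px px' σ! lnk
    with e≡n ← neighbour (~-sym (Linked.head (Linked-++⁻ʳ A lnk))) px
    with refl ← neighbour (Linked.head (Linked.tail (Linked-++⁻ʳ A lnk))) px'
    with refl ← e≡n
    = Unique-++-disjoint (_ ∷ []) (Unique-++⁻ʳ A σ!) (here refl) (there (here refl))

  balance-sum : ∀ {a b c a' b' c' p q r} → a + (b + c) ≡ 2 + (a' + (b' + c')) →
    a + 1 ≡ a' + p → b + 1 ≡ b' + q → c + 1 ≡ c' + r → p + q + r ≡ 5
  balance-sum {a} {b} {c} {a'} {b'} {c'} {p} {q} {r} total ea eb ec =
    ℕ.+-cancelˡ-≡ (a' + (b' + c')) (p + q + r) 5 (begin
      (a' + (b' + c')) + (p + q + r)    ≡⟨ regroup a' b' c' p q r ⟩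
      (a' + p) + ((b' + q) + (c' + r))  ≡⟨ sym (cong₂ _+_ ea (cong₂ _+_ eb ec)) ⟩
      (a + 1) + ((b + 1) + (c + 1))     ≡⟨ three a b c ⟩
      3 + (a + (b + c))                 ≡⟨ cong (3 +_) total ⟩
      3 + (2 + (a' + (b' + c')))        ≡⟨ ℕ.+-comm 5 (a' + (b' + c')) ⟩
      (a' + (b' + c')) + 5              ∎)
    where
    open ≡-Reasoning
    regroup : ∀ a b c p q r → (a + (b + c)) + (p + q + r) ≡ (a + p) + ((b + q) + (c + r))
    regroup = solve-∀
    three : ∀ a b c → (a + 1) + ((b + 1) + (c + 1)) ≡ 3 + (a + (b + c))
    three = solve-∀

  module _ {na za zb nb} (m : Middle na za zb nb) (P Q R : List V)
    (σ! : Unique (P ++ za ∷ Q ++ zb ∷ R)) (lnk : Linked _~_ (P ++ za ∷ Q ++ zb ∷ R))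
    (xyP : All IsXY P) (xyQ : All IsXY Q) (xyR : All IsXY R)
    (countX : nX (P ++ za ∷ Q ++ zb ∷ R) ≡ 2 + nY (P ++ za ∷ Q ++ zb ∷ R)) where

    private
      lnkP = Linked-++⁻ˡ P lnk
      lnk-za = Linked-++⁻ʳ P lnk
      lnkQR = Linked.tail lnk-za
      lnkQ = Linked-++⁻ˡ Q lnkQR
      lnkR = Linked.tail (Linked-++⁻ʳ Q lnkQR)

      count : ∀ {Pr} (Pr? : Decidable Pr) → ¬ Pr za → ¬ Pr zb →
        length (filter Pr? (P ++ za ∷ Q ++ zb ∷ R)) ≡
        length (filter Pr? P) + (length (filter Pr? Q) + length (filter Pr? R))
      count Pr? ¬za ¬zb = trans (length-filter-++-∷ Pr? P ¬za)
                                (cong (length (filter Pr? P) +_) (length-filter-++-∷ Pr? Q ¬zb))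

      total : excess (shape P) + excess (shape Q) + excess (shape R) ≡ 5
      total = balance-sum {a' = nY P} {nY Q} {nY R}
        (trans (sym (count IsX? (¬IsXY-za m ∘ inj₁) (¬IsXY-zb m ∘ inj₁)))
          (trans countX (cong (2 +_) (count IsY? (¬IsXY-za m ∘ inj₂) (¬IsXY-zb m ∘ inj₂)))))
        (balance xyP lnkP) (balance xyQ lnkQ) (balance xyR lnkR)

      conflict-za : ¬ (EndsX (shape P) × StartsX (shape Q))
      conflict-za (ex , sx) with P' , e , refl , px ← EndsX⇒∷ʳ P ex | e' , Q' , refl , px' ← StartsX⇒∷ Q sx =
        x-neighbour-once (x-neighbourˡ m) P' px px'
          (subst Unique (List.++-assoc P' (e ∷ []) _) σ!) (subst (Linked _~_) (List.++-assoc P' (e ∷ []) _) lnk)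

      conflict-zb : ¬ (EndsX (shape Q) × StartsX (shape R))
      conflict-zb (ex , sx) with Q' , e , refl , px ← EndsX⇒∷ʳ Q ex | e' , R' , refl , px' ← StartsX⇒∷ R sx =
        x-neighbour-once (x-neighbourʳ m) Q' px px'
          (subst Unique (List.++-assoc Q' (e ∷ []) _) (Unique-∷⁻ (Unique-++⁻ʳ P σ!)))
          (subst (Linked _~_) (List.++-assoc Q' (e ∷ []) _) lnkQR)

    segment-shapes : shape P ≡ XX × Q ≡ [] × shape R ≡ XX
    segment-shapes with three-segments (shape P) (shape Q) (shape R) total conflict-za conflict-zb
    ... | P≡ , Q≡ , R≡ = P≡ , shape≡empty Q Q≡ , R≡
      where
      shape≡empty : ∀ l → shape l ≡ empty → l ≡ []
      shape≡empty [] _ = refl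

  σ-structure : ∀ {na za zb nb} → Middle na za zb nb → ∀ P Q R →
    Unique (P ++ za ∷ Q ++ zb ∷ R) → Linked _~_ (P ++ za ∷ Q ++ zb ∷ R) →
    All IsXY P → All IsXY Q → All IsXY R →
    nX (P ++ za ∷ Q ++ zb ∷ R) ≡ 2 + nY (P ++ za ∷ Q ++ zb ∷ R) →
    ∃ λ as → ∃ λ bs → ∃ λ bs' → ∃ λ as' →
      P ++ za ∷ Q ++ zb ∷ R ≡ interleave as bs ++ na ∷ za ∷ zb ∷ nb ∷ interleave bs' as' ×
      All IsX as × All IsY bs × All IsY bs' × All IsX as' × length as ≡ length bs × length bs' ≡ length as'
  σ-structure {za = za} {zb} m P Q R σ! lnk xyP xyQ xyR countX
    with P≡ , refl , R≡ ← segment-shapes m P Q R σ! lnk xyP xyQ xyR countX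
    with as , bs , e , refl , x-as , y-bs , x-e , as≡bs ← XX-segment xyP (Linked-++⁻ˡ P lnk) P≡
    with as₀ , bs' , e₀ , refl , x-as₀ , y-bs' , x-e₀ , as₀≡bs' ←
           XX-segment xyR (Linked.tail (Linked.tail (Linked-++⁻ʳ P lnk))) R≡
    with e' , as' , e'∷as'≡ , bs'≡as' , rotate ← interleave-∷ʳ as₀ bs' {e₀} as₀≡bs'
    with x-e'∷as' ← subst (All IsX) (sym e'∷as'≡) (All-++⁺ x-as₀ (x-e₀ ∷ []))
    with refl ← x-neighbourˡ m (~-sym (Linked.head (Linked-++⁻ʳ (interleave as bs) (subst (Linked _~_) (List.++-assoc (interleave as bs) (e ∷ []) _) lnk)))) x-e
    with refl ← x-neighbourʳ m (Linked.head (subst (Linked _~_ ∘ (zb ∷_)) rotate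
                                   (Linked.tail (Linked-++⁻ʳ P lnk)))) (All.head x-e'∷as')
    = as , bs , bs' , as' , trans (List.++-assoc (interleave as bs) (e ∷ []) _) (cong (λ l → interleave as bs ++ e ∷ za ∷ zb ∷ l) rotate) ,
      x-as , y-bs , y-bs' , All.tail x-e'∷as' , as≡bs , bs'≡as'

  Middle-ends : ∀ {na za zb nb} → Middle na za zb nb → ∀ {w} → IsEnd w → w ≡ na ⊎ w ≡ nb
  Middle-ends forward (inj₁ refl) = inj₁ refl
  Middle-ends forward (inj₂ refl) = inj₂ refl
  Middle-ends backward (inj₁ refl) = inj₂ refl
  Middle-ends backward (inj₂ refl) = inj₁ refl

  Middle-IsEnd : ∀ {na za zb nb} → Middle na za zb nb → IsEnd na × IsEnd nb
  Middle-IsEnd forward = inj₁ refl , inj₂ refl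
  Middle-IsEnd backward = inj₂ refl , inj₁ refl

  Middle-IsXY : ∀ {na za zb nb} → Middle na za zb nb → ∀ {w} → w ≡ z₃ ⊎ w ≡ z₄ ⊎ IsXY w →
    w ≢ za → w ≢ zb → IsXY w
  Middle-IsXY _ (inj₂ (inj₂ xy)) _ _ = xy
  Middle-IsXY forward (inj₁ e) w≢za _ = ⊥-elim (w≢za e)
  Middle-IsXY forward (inj₂ (inj₁ e)) _ w≢zb = ⊥-elim (w≢zb e)
  Middle-IsXY backward (inj₁ e) _ w≢zb = ⊥-elim (w≢zb e)
  Middle-IsXY backward (inj₂ (inj₁ e)) w≢za _ = ⊥-elim (w≢za e)

  filter-IsX-Middle : ∀ {na za zb nb} → Middle na za zb nb → ∀ L →
    filter IsX? (na ∷ za ∷ zb ∷ nb ∷ L) ≡ na ∷ nb ∷ filter IsX? L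
  filter-IsX-Middle forward _ = refl
  filter-IsX-Middle backward _ = refl

  filter-IsY-Middle : ∀ {na za zb nb} → Middle na za zb nb → ∀ L →
    filter IsY? (na ∷ za ∷ zb ∷ nb ∷ L) ≡ filter IsY? L
  filter-IsY-Middle forward _ = refl
  filter-IsY-Middle backward _ = refl

  crossing-for : ∀ {na za zb nb} → Middle na za zb nb → ∀ as as' {bs bs'} →
    length as + length as' ≡ 1 + k → length as ≡ length bs → length bs' ≡ length as' →
    Linked _~_ (z₂ ∷ (interleave as bs ++ na ∷ za ∷ zb ∷ nb ∷ interleave bs' as') ++ v ∷ []) →
    ∃ λ c → (U ⟨⊎⟩ U) c × split c ≡ length as × middle c ≡ na ∷ za ∷ zb ∷ nb ∷ []
  crossing-for forward as as' total _ _ _ =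
    inj₁ (fromℕ< as<) , tt , Fin.toℕ-fromℕ< as< , refl
    where
    as< : length as < 2 + k
    as< = s≤s (subst (length as ≤_) total (ℕ.m≤m+n (length as) (length as')))
  crossing-for backward [] _ {[]} _ _ _ lnk = ⊥-elim (¬z₂~xᵣ₋₂ (Linked.head lnk))
  crossing-for backward as@(_ ∷ _) [] {bs} {[]} _ _ _ lnk =
    ⊥-elim (¬x₁~v (Linked.head (Linked.tail (Linked.tail (Linked.tail
      (Linked-++⁻ʳ (z₂ ∷ interleave as bs)
        (subst (Linked _~_ ∘ (z₂ ∷_)) (List.++-assoc (interleave as bs) _ (v ∷ [])) lnk)))))))
  crossing-for backward (_ ∷ as₁) (_ ∷ as₁') total _ _ _ =
    inj₂ (fromℕ< as₁<) , tt , cong suc (Fin.toℕ-fromℕ< as₁<) , refl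
    where
    as₁< : length as₁ < k
    as₁< = subst (length as₁ <_) (ℕ.suc-injective total) (ℕ.m<m+n (length as₁) (s≤s z≤n))

  y⇒¬IsX : ∀ {w} → IsY w → ¬ IsX w
  y⇒¬IsX (_ , refl) (_ , ())

  x⇒¬IsY : ∀ {w} → IsX w → ¬ IsY w
  x⇒¬IsY (_ , refl) (_ , ())

  module _ {na za zb nb} (m : Middle na za zb nb) {as bs bs' as' : List V}
    (x-as : All IsX as) (y-bs : All IsY bs) (y-bs' : All IsY bs') (x-as' : All IsX as')
    (as≡bs : length as ≡ length bs) (bs'≡as' : length bs' ≡ length as') where

    private
      σ : List V
      σ = interleave as bs ++ na ∷ za ∷ zb ∷ nb ∷ interleave bs' as'

    filter-IsX-structure : filter IsX? σ ≡ as ++ na ∷ nb ∷ as'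
    filter-IsX-structure = trans (List.filter-++ IsX? (interleave as bs) _)
      (cong₂ _++_ (filter-interleave-accept IsX? x-as (All.map y⇒¬IsX y-bs) as≡bs)
                  (trans (filter-IsX-Middle m (interleave bs' as'))
                         (cong (λ l → na ∷ nb ∷ l) (filter-interleave-reject IsX? (All.map y⇒¬IsX y-bs') x-as' bs'≡as'))))

    filter-IsY-structure : filter IsY? σ ≡ bs ++ bs'
    filter-IsY-structure = trans (List.filter-++ IsY? (interleave as bs) _)
      (cong₂ _++_ (filter-interleave-reject IsY? (All.map x⇒¬IsY x-as) y-bs as≡bs)
                  (trans (filter-IsY-Middle m (interleave bs' as'))
                         (filter-interleave-accept IsY? y-bs' (All.map x⇒¬IsY x-as') bs'≡as')))

    inner-arrangement : Unique σ → (∀ j → inner j ∈ σ) → Arrangement inners (as ++ as')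
    inner-arrangement σ! inner∈σ = Unique-removeMid as (Unique-removeMid as xs!) , α⊆ , ⊆α
      where
      xs! : Unique (as ++ na ∷ nb ∷ as')
      xs! = subst Unique filter-IsX-structure (Unique.filter⁺ IsX? σ!)
      not-end : ∀ {w} → w ∈ as ++ as' → ¬ IsEnd w
      not-end w∈ end with Middle-ends m end
      ... | inj₁ refl = Unique-mid∉ as xs! (∈-++-∷⁺ as w∈)
      ... | inj₂ refl = Unique-mid∉ as (Unique-removeMid as xs!) w∈
      α⊆ : as ++ as' ⊆ inners
      α⊆ w∈ with All.lookup (All-++⁺ x-as x-as') w∈
      ... | i , refl with x-view i
      ...   | is-first = ⊥-elim (not-end w∈ (inj₁ refl))
      ...   | is-last = ⊥-elim (not-end w∈ (inj₂ refl))
      ...   | is-inner j = ∈-tabulate⁺ inner j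
      ⊆α : inners ⊆ as ++ as'
      ⊆α w∈ with j , refl ← ∈-tabulate⁻ inner w∈
        with ∈-++-∷⁻ as (subst (inner j ∈_) filter-IsX-structure (∈-filter⁺ IsX? (inner∈σ j) (_ , refl)))
      ... | inj₁ refl = ⊥-elim (inner-¬IsEnd (j , refl) (proj₁ (Middle-IsEnd m)))
      ... | inj₂ w∈′ with ∈-++-∷⁻ as w∈′
      ...   | inj₁ refl = ⊥-elim (inner-¬IsEnd (j , refl) (proj₂ (Middle-IsEnd m)))
      ...   | inj₂ w∈″ = w∈″

    y-arrangement : Unique σ → (∀ j → y j ∈ σ) → Arrangement ys (bs ++ bs')
    y-arrangement σ! y∈σ = subst Unique filter-IsY-structure (Unique.filter⁺ IsY? σ!) , β⊆ , ⊆β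
      where
      β⊆ : bs ++ bs' ⊆ ys
      β⊆ w∈ with j , refl ← All.lookup (All-++⁺ y-bs y-bs') w∈ = ∈-tabulate⁺ y j
      ⊆β : ys ⊆ bs ++ bs'
      ⊆β w∈ with j , refl ← ∈-tabulate⁻ y w∈ =
        subst (y j ∈_) filter-IsY-structure (∈-filter⁺ IsY? (y∈σ j) (_ , refl))

  from-structure : ∀ {na za zb nb} → Middle na za zb nb → ∀ {π} as bs bs' as' →
    let σ = interleave as bs ++ na ∷ za ∷ zb ∷ nb ∷ interleave bs' as' in
    Arrangement ts π → Unique σ → Linked _~_ (z₂ ∷ σ ++ v ∷ []) → (∀ j → inner j ∈ σ) → (∀ j → y j ∈ σ) →
    All IsX as → All IsY bs → All IsY bs' → All IsX as' → length as ≡ length bs → length bs' ≡ length as' →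
    ∃ λ ps → Valid ps × path ps ≡ u ∷ u' ∷ π ++ z₁' ∷ z₁ ∷ z₂ ∷ σ ++ v ∷ []
  from-structure {na} {za} {zb} {nb} m {π} as bs bs' as' π-arr σ! lnk inner∈σ y∈σ x-as y-bs y-bs' x-as' as≡bs bs'≡as'
    = finish (crossing-for m as as' α-length as≡bs bs'≡as' lnk)
    where
    α-arr = inner-arrangement m x-as y-bs y-bs' x-as' as≡bs bs'≡as' σ! inner∈σ
    β-arr = y-arrangement m x-as y-bs y-bs' x-as' as≡bs bs'≡as' σ! y∈σ
    α-length : length as + length as' ≡ 1 + k
    α-length = trans (sym (List.length-++ as)) (Arrangement-tabulate-length Unique-inners α-arr)
    finish : (∃ λ c → (U ⟨⊎⟩ U) c × split c ≡ length as × middle c ≡ na ∷ za ∷ zb ∷ nb ∷ []) →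
      ∃ λ ps → Valid ps × path ps ≡ u ∷ u' ∷ π ++ z₁' ∷ z₁ ∷ z₂ ∷ (interleave as bs ++ na ∷ za ∷ zb ∷ nb ∷ interleave bs' as') ++ v ∷ []
    finish (c , c-valid , split≡ , middle≡) =
      (π , c , as ++ as' , bs ++ bs') , (π-arr , c-valid , α-arr , β-arr) ,
      cong (λ l → u ∷ u' ∷ π ++ z₁' ∷ z₁ ∷ z₂ ∷ l ++ v ∷ []) (begin
        weave (split c) (as ++ as') (bs ++ bs') (middle c)
          ≡⟨ cong₂ (λ n mid → weave n (as ++ as') (bs ++ bs') mid) split≡ middle≡ ⟩
        weave (length as) (as ++ as') (bs ++ bs') (na ∷ za ∷ zb ∷ nb ∷ [])
          ≡⟨ weave-length-++ as (na ∷ za ∷ zb ∷ nb ∷ []) as≡bs ⟩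
        interleave as bs ++ na ∷ za ∷ zb ∷ nb ∷ interleave bs' as' ∎)
      where open ≡-Reasoning

  module Decompose (π σ : List V)
    (p! : Unique (u ∷ u' ∷ π ++ z₁' ∷ z₁ ∷ z₂ ∷ σ ++ v ∷ []))
    (lnk : Linked _~_ (u ∷ u' ∷ π ++ z₁' ∷ z₁ ∷ z₂ ∷ σ ++ v ∷ []))
    (∈p : ∀ w → w ∈ u ∷ u' ∷ π ++ z₁' ∷ z₁ ∷ z₂ ∷ σ ++ v ∷ [])
    (inπ : All InClique π) (outside : All (¬_ ∘ InClique) (z₂ ∷ σ ++ v ∷ [])) where

    private
      π-rest! : Unique (π ++ z₁' ∷ z₁ ∷ z₂ ∷ σ ++ v ∷ [])
      π-rest! = Unique-∷⁻ (Unique-∷⁻ p!)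

      rest! : Unique (z₁' ∷ z₁ ∷ z₂ ∷ σ ++ v ∷ [])
      rest! = Unique-++⁻ʳ π π-rest!

      σv! : Unique (σ ++ v ∷ [])
      σv! = Unique-∷⁻ (Unique-∷⁻ (Unique-∷⁻ rest!))

    σ! : Unique σ
    σ! = Unique-++⁻ˡ σ σv!

    Linked-z₂σv : Linked _~_ (z₂ ∷ σ ++ v ∷ [])
    Linked-z₂σv = Linked.tail (Linked.tail (Linked-++⁻ʳ π (Linked.tail (Linked.tail lnk))))

    Linked-σ : Linked _~_ σ
    Linked-σ = Linked-++⁻ˡ σ (Linked.tail Linked-z₂σv)

    π-arr : Arrangement ts π
    π-arr = Unique-++⁻ˡ π π-rest! , π⊆ , ⊆π
      where
      π⊆ : π ⊆ ts
      π⊆ w∈ with All.lookup inπ w∈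
      ... | u'∈K = ⊥-elim (Unique[x∷xs]⇒x∉xs (Unique-∷⁻ p!) (∈-++⁺ˡ w∈))
      ... | z₁'∈K = ⊥-elim (Unique-mid∉ π π-rest! (∈-++⁺ˡ w∈))
      ... | t∈K l = ∈-tabulate⁺ t l
      ⊆π : ts ⊆ π
      ⊆π w∈ with l , refl ← ∈-tabulate⁻ t w∈ with ∈p (t l)
      ... | there (there t∈) with ∈-++⁻ π t∈
      ...   | inj₁ t∈π = t∈π
      ...   | inj₂ (there (there t∈tail)) = ⊥-elim (All.lookup outside t∈tail (t∈K l))

    ∈σ : ∀ {w} → ¬ InClique w → w ≢ u → w ≢ z₁ → w ≢ z₂ → w ≢ v → w ∈ σ
    ∈σ {w} ¬cw w≢u w≢z₁ w≢z₂ w≢v with ∈p w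
    ... | here e = ⊥-elim (w≢u e)
    ... | there (here refl) = ⊥-elim (¬cw u'∈K)
    ... | there (there w∈) with ∈-++⁻ π w∈
    ...   | inj₁ w∈π = ⊥-elim (¬cw (All.lookup inπ w∈π))
    ...   | inj₂ (here refl) = ⊥-elim (¬cw z₁'∈K)
    ...   | inj₂ (there (here e)) = ⊥-elim (w≢z₁ e)
    ...   | inj₂ (there (there (here e))) = ⊥-elim (w≢z₂ e)
    ...   | inj₂ (there (there (there w∈σv))) with ∈-++⁻ σ w∈σv
    ...     | inj₁ w∈σ = w∈σ
    ...     | inj₂ (here e) = ⊥-elim (w≢v e)

    x∈σ : ∀ i → x i ∈ σ
    x∈σ i = ∈σ (λ ()) (λ ()) (λ ()) (λ ()) (λ ())

    y∈σ : ∀ j → y j ∈ σ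
    y∈σ j = ∈σ (λ ()) (λ ()) (λ ()) (λ ()) (λ ())

    classify : ∀ {w} → w ∈ σ → w ≡ z₃ ⊎ w ≡ z₄ ⊎ IsXY w
    classify {z₃} _ = inj₁ refl
    classify {z₄} _ = inj₂ (inj₁ refl)
    classify {x i} _ = inj₂ (inj₂ (inj₁ (i , refl)))
    classify {y j} _ = inj₂ (inj₂ (inj₂ (j , refl)))
    classify {u} w∈ = ⊥-elim (Unique[x∷xs]⇒x∉xs p! (there (∈-++⁺ʳ π (there (there (there (∈-++⁺ˡ w∈)))))))
    classify {v} w∈ = ⊥-elim (Unique-mid∉ σ σv! (∈-++⁺ˡ w∈))
    classify {z₁} w∈ = ⊥-elim (Unique[x∷xs]⇒x∉xs (Unique-∷⁻ rest!) (there (∈-++⁺ˡ w∈)))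
    classify {z₂} w∈ = ⊥-elim (Unique[x∷xs]⇒x∉xs (Unique-∷⁻ (Unique-∷⁻ rest!)) (∈-++⁺ˡ w∈))
    classify {u'} w∈ = ⊥-elim (All.lookup outside (there (∈-++⁺ˡ w∈)) u'∈K)
    classify {z₁'} w∈ = ⊥-elim (All.lookup outside (there (∈-++⁺ˡ w∈)) z₁'∈K)
    classify {t l} w∈ = ⊥-elim (All.lookup outside (there (∈-++⁺ˡ w∈)) (t∈K l))

    private
      count : ∀ {n} (f : Fin n → V) {Pr : V → Set} (Pr? : Decidable Pr) → Unique (map f (allFin n)) →
        (∀ {w} → Pr w → w ∈ map f (allFin n)) → (∀ i → Pr (f i)) → (∀ i → f i ∈ σ) →
        length (filter Pr? σ) ≡ n
      count f Pr? f! sound Pf f∈σ = Arrangement-tabulate-length f!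
        (Unique.filter⁺ Pr? σ! , (λ w∈ → sound (proj₂ (∈-filter⁻ Pr? {xs = σ} w∈))) ,
         λ w∈ → let i , e = ∈-tabulate⁻ f w∈ in subst (_∈ filter Pr? σ) (sym e) (∈-filter⁺ Pr? (f∈σ i) (Pf i)))

    nX≡2+nY : nX σ ≡ 2 + nY σ
    nX≡2+nY = trans (count x IsX? Unique-xs (λ { (i , refl) → ∈-tabulate⁺ x i }) (λ i → i , refl) x∈σ)
                    (cong (2 +_) (sym (count y IsY? Unique-ys (λ { (j , refl) → ∈-tabulate⁺ y j }) (λ j → j , refl) y∈σ)))

    middle-split : ∃ λ na → ∃ λ za → ∃ λ zb → ∃ λ nb → ∃ λ P → ∃ λ Q → ∃ λ R →
      Middle na za zb nb × σ ≡ P ++ za ∷ Q ++ zb ∷ R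
    middle-split with σ₁ , σ₂ , σ≡ ← ∈-∃++ (∈σ {z₃} (λ ()) (λ ()) (λ ()) (λ ()) (λ ()))
      with ∈-++⁻ σ₁ (subst (z₄ ∈_) σ≡ (∈σ {z₄} (λ ()) (λ ()) (λ ()) (λ ()) (λ ())))
    ... | inj₂ (there z₄∈σ₂) with Q , R , σ₂≡ ← ∈-∃++ z₄∈σ₂ =
      _ , _ , _ , _ , σ₁ , Q , R , forward , trans σ≡ (cong (λ l → σ₁ ++ z₃ ∷ l) σ₂≡)
    ... | inj₁ z₄∈σ₁ with P , Q , σ₁≡ ← ∈-∃++ z₄∈σ₁ =
      _ , _ , _ , _ , P , Q , σ₂ , backward ,
      trans σ≡ (trans (cong (_++ z₃ ∷ σ₂) σ₁≡) (List.++-assoc P (z₄ ∷ Q) (z₃ ∷ σ₂)))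

    segments-IsXY : ∀ {na za zb nb} → Middle na za zb nb → ∀ P Q R → σ ≡ P ++ za ∷ Q ++ zb ∷ R →
      All IsXY P × All IsXY Q × All IsXY R
    segments-IsXY m P Q R σ≡ =
      All.tabulate (λ w∈ → xy (∈-++⁺ˡ w∈) (λ { refl → Unique-mid∉ P σ!′ (∈-++⁺ˡ w∈) })
                                           (λ { refl → Unique-++-disjoint P σ!′ w∈ (there (∈-++⁺ʳ Q (here refl))) })) ,
      All.tabulate (λ w∈ → xy (∈-++⁺ʳ P (there (∈-++⁺ˡ w∈))) (λ { refl → Unique-mid∉ P σ!′ (∈-++⁺ʳ P (∈-++⁺ˡ w∈)) })
                                                             (λ { refl → Unique-mid∉ Q QR! (∈-++⁺ˡ w∈) })) ,
      All.tabulate (λ w∈ → xy (∈-++⁺ʳ P (there (∈-++⁺ʳ Q (there w∈))))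
                              (λ { refl → Unique-mid∉ P σ!′ (∈-++⁺ʳ P (∈-++⁺ʳ Q (there w∈))) })
                              (λ { refl → Unique-mid∉ Q QR! (∈-++⁺ʳ Q w∈) }))
      where
      σ!′ = subst Unique σ≡ σ!
      QR! = Unique-∷⁻ (Unique-++⁻ʳ P σ!′)
      xy : ∀ {w} → w ∈ P ++ _ ∷ Q ++ _ ∷ R → _ → _ → IsXY w
      xy w∈ = Middle-IsXY m (classify (subst (_ ∈_) (sym σ≡) w∈))

    parameters : ∃ λ ps → Valid ps × path ps ≡ u ∷ u' ∷ π ++ z₁' ∷ z₁ ∷ z₂ ∷ σ ++ v ∷ []
    parameters with na , za , zb , nb , P , Q , R , m , σ≡ ← middle-split
      with xyP , xyQ , xyR ← segments-IsXY m P Q R σ≡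
      with as , bs , bs' , as' , σ≡′ , x-as , y-bs , y-bs' , x-as' , as≡bs , bs'≡as' ←
             σ-structure m P Q R (subst Unique σ≡ σ!) (subst (Linked _~_) σ≡ Linked-σ) xyP xyQ xyR
               (subst (λ l → nX l ≡ 2 + nY l) σ≡ nX≡2+nY)
      with σ≡″ ← trans σ≡ σ≡′
      = subst (λ l → ∃ λ ps → Valid ps × path ps ≡ u ∷ u' ∷ π ++ z₁' ∷ z₁ ∷ z₂ ∷ l ++ v ∷ []) (sym σ≡″)
          (from-structure m as bs bs' as' π-arr (subst Unique σ≡″ σ!)
            (subst (λ l → Linked _~_ (z₂ ∷ l ++ v ∷ [])) σ≡″ Linked-z₂σv)
            (λ j → subst (inner j ∈_) σ≡″ (x∈σ _)) (λ j → subst (y j ∈_) σ≡″ (y∈σ j))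
            x-as y-bs y-bs' x-as' as≡bs bs'≡as')

  z₂-after-z₁ : ∀ (π B : List V) → Unique (u ∷ u' ∷ π ++ z₁' ∷ z₁ ∷ B) → UsesEdge z₁ z₂ (u ∷ u' ∷ π ++ z₁' ∷ z₁ ∷ B) →
    ∃ λ s → B ≡ z₂ ∷ s
  z₂-after-z₁ π B p! (pre , post , e) = go e
    where
    L₀ = u ∷ u' ∷ π ++ z₁' ∷ []
    L₀-split : u ∷ u' ∷ π ++ z₁' ∷ z₁ ∷ B ≡ L₀ ++ z₁ ∷ B
    L₀-split = cong (λ l → u ∷ u' ∷ l) (sym (List.++-assoc π (z₁' ∷ []) (z₁ ∷ B)))
    z₁∉ : ∀ xs {ys} → Unique (xs ++ z₁ ∷ ys) → z₁ ∉ xs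
    z₁∉ xs xs! = Unique-mid∉ xs xs! ∘ ∈-++⁺ˡ
    split-at-z₁ : ∀ {xs ys} → u ∷ u' ∷ π ++ z₁' ∷ z₁ ∷ B ≡ xs ++ z₁ ∷ ys → L₀ ≡ xs × B ≡ ys
    split-at-z₁ {xs} e = ++-∷-injective L₀ (z₁∉ L₀ (subst Unique L₀-split p!)) (z₁∉ xs (subst Unique e p!))
                           (trans (sym L₀-split) e)
    go : (u ∷ u' ∷ π ++ z₁' ∷ z₁ ∷ B ≡ pre ++ z₁ ∷ z₂ ∷ post) ⊎ (u ∷ u' ∷ π ++ z₁' ∷ z₁ ∷ B ≡ pre ++ z₂ ∷ z₁ ∷ post) →
      ∃ λ s → B ≡ z₂ ∷ s
    go (inj₁ e) = post , proj₂ (split-at-z₁ e)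
    go (inj₂ e) with () ← proj₂ (List.∷ʳ-injective (u ∷ u' ∷ π) pre
                            (proj₁ (split-at-z₁ (trans e (sym (List.++-assoc pre (z₂ ∷ []) (z₁ ∷ post)))))))

  path-surjective : ∀ {p} → HamUVPathVia p → ∃ λ ps → Valid ps × path ps ≡ p
  path-surjective {_ ∷ q} ((refl , last≡ , lnk , p! , ∈p) , uses)
    with π , B , refl , inπ , outside ← clique-block p! lnk last≡ (Any.tail (λ ()) (∈p u'))
    with s , refl ← z₂-after-z₁ π B p! uses
    with last⇒∷ʳ (z₂ ∷ s) (trans (sym (last-++-∷ (u ∷ u' ∷ π) (z₁ ∷ z₂ ∷ s))) last≡)
  ... | z₂ ∷ σ , eq with refl ← List.∷-injectiveʳ eq =
    Decompose.parameters π σ p! lnk ∈p inπ outside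

  HasCard-Valid : HasCard Parameters Valid ((4 + k) ! * ((2 + k + k) * ((1 + k) ! * (1 + k) !)))
  HasCard-Valid = subst (HasCard Parameters Valid) size
    (HasCard-× (HasCard-Arrangement ts Unique-ts)
      (HasCard-× (HasCard-⊎ (HasCard-Fin (2 + k)) (HasCard-Fin k))
        (HasCard-× (HasCard-Arrangement inners Unique-inners) (HasCard-Arrangement ys Unique-ys))))
    where
    size : length ts ! * ((2 + k + k) * (length inners ! * length ys !)) ≡
           (4 + k) ! * ((2 + k + k) * ((1 + k) ! * (1 + k) !))
    size = cong₂ (λ a b → a ! * ((2 + k + k) * b)) (length-tabulate (t {r}))
                 (cong₂ (λ a b → a ! * b !) (length-tabulate inner) (length-tabulate (y {r})))

  paths-through-z₁z₂ : HasCard (List V) HamUVPathVia ((2 * r ∸ 8) * (((r ∸ 4) !) ^ 2) * ((r ∸ 1) !))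
  paths-through-z₁z₂ = subst (HasCard (List V) HamUVPathVia) count
    (HasCard-bijection path path-HamUVPathVia path-injective path-surjective HasCard-Valid)
    where
    rearrange : ∀ a b c → b * (c * (a * a)) ≡ c * (a * (a * 1)) * b
    rearrange = solve-∀
    2r∸8 : 2 * r ∸ 8 ≡ 2 + k + k
    2r∸8 = trans (cong (_∸ 8) (double k)) (ℕ.m+n∸m≡n 8 (2 + k + k))
      where
      double : ∀ k → 2 * (5 + k) ≡ 8 + (2 + k + k)
      double = solve-∀
    count : (4 + k) ! * ((2 + k + k) * ((1 + k) ! * (1 + k) !)) ≡ (2 * r ∸ 8) * (((r ∸ 4) !) ^ 2) * ((r ∸ 1) !)
    count = trans (rearrange ((1 + k) !) ((4 + k) !) (2 + k + k))
                  (cong (λ c → c * (((1 + k) !) ^ 2) * ((4 + k) !)) (sym 2r∸8))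

mainTheorem4 : (r : ℕ) → 5 ≤ r →
    HasCard (Vtx r) (λ _ → ⊤) (3 * r + 1) ×
    HasDegree r u (r ∸ 1) ×
    HasDegree r v (r ∸ 1) ×
    (∀ w → w ≢ u → w ≢ v → HasDegree r w r) ×
    HasCard (List (Vtx r)) (λ p → HamUVPath r p × UsesEdge z₁ z₂ p)
      ((2 * r ∸ 8) * (((r ∸ 4) !) ^ 2) * ((r ∸ 1) !))
mainTheorem4 r 5≤r with k , refl ← ℕ.m≤n⇒∃[o]m+o≡n 5≤r =
  order , degree-u , degree-v , degree-other , paths-through-z₁z₂
  where
  open OrderAndDegrees k
  open Surjectivity k
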